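{- For every integer $n\ge 1$: (1) $af(G_n)=n$ and $Af(G_n)=3n$; (2) the anti-forcing spectrum of $G_n$ is $\{n,n+1,\ldots,3n\}$.
   Context: For a positive integer $n$, $G_n$ is the plane graph (a polyomino graph with $4n$ unit square faces) with vertex set $\{u_0,v_0\}\cup\{u_i,v_i,w_i,z_i: 1\le i\le 2n\}$, drawn with $w_i$ at $(i,3)$, $u_i$ at $(i,2)$, $v_i$ at $(i,1)$, $z_i$ at $(i,0)$ (and $u_0$ at $(0,2)$, $v_0$ at $(0,1)$), and edge set consisting of: $u_{i-1}u_i$ and $v_{i-1}v_i$ for $1\le i\le 2n$; $u_iv_i$ for $0\le i\le 2n$; $w_iu_i$ and $v_iz_i$ for $1\le i\le 2n$; $w_{2j-1}w_{2j}$ and $z_{2j-1}z_{2j}$ for $1\le j\le n$. For a perfect matching $M$ of a graph $G$, a set $S'\subseteq E(G)\setminus M$ is an anti-forcing set of $M$ if $G-S'$ has a unique perfect matching (namely $M$); the anti-forcing number $af(G,M)$ is the minimum size of an anti-forcing set of $M$. The anti-forcing spectrum of $G$ is the set $\{af(G,M)\}$ over all perfect matchings $M$ of $G$; $af(G)$ and $Af(G)$ denote its minimum and maximum. -}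

module Defs where

open import Data.Nat using (ℕ; zero; suc; _+_; _*_; _≤_)
open import Data.Fin using (Fin)
open import Data.Fin.Subset using (Subset; _∈_; _∉_; ∣_∣)
open import Data.List using (List; []; _∷_; _++_; applyUpTo; concatMap; length; lookup)
open import Data.Product using (_×_; _,_; ∃-syntax; Σ-syntax)
open import Data.Sum using (_⊎_)
open import Relation.Binary.PropositionalEquality using (_≡_)
import Data.List.Membership.Propositional as LM

record Graph (V : Set) : Set where
  field
    vertices : List V
    edges    : List (V × V)

open Graph public

EdgeIx : ∀ {V} → Graph V → Set
EdgeIx G = Fin (length (edges G))

EdgeSet : ∀ {V} → Graph V → Set
EdgeSet G = Subset (length (edges G))

endpoints : ∀ {V} (G : Graph V) → EdgeIx G → V × V
endpoints G e = lookup (edges G) e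

Incident : ∀ {V} (G : Graph V) → V → EdgeIx G → Set
Incident G x e with endpoints G e
... | (a , b) = (x ≡ a) ⊎ (x ≡ b)

IsPerfectMatching : ∀ {V} (G : Graph V) → EdgeSet G → Set
IsPerfectMatching {V} G M =
  (x : V) → LM._∈_ x (vertices G) →
    (∃[ e ] (e ∈ M × Incident G x e)) ×
    (∀ e e' → e ∈ M → e' ∈ M → Incident G x e → Incident G x e' → e ≡ e')

-- S is an anti-forcing set of the perfect matching M:
-- S ⊆ E(G) \ M and M is the unique perfect matching of G - S
-- (perfect matchings of G - S = perfect matchings of G avoiding S).
IsAntiForcingSet : ∀ {V} (G : Graph V) → EdgeSet G → EdgeSet G → Set
IsAntiForcingSet G M S =
  (∀ e → e ∈ S → e ∉ M) ×
  (∀ M' → IsPerfectMatching G M' → (∀ e → e ∈ S → e ∉ M') → M' ≡ M)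

AntiForcingNumber : ∀ {V} (G : Graph V) → EdgeSet G → ℕ → Set
AntiForcingNumber G M k =
  (Σ[ S ∈ EdgeSet G ] (IsAntiForcingSet G M S × ∣ S ∣ ≡ k)) ×
  (∀ S → IsAntiForcingSet G M S → k ≤ ∣ S ∣)

InAntiForcingSpectrum : ∀ {V} (G : Graph V) → ℕ → Set
InAntiForcingSpectrum G k =
  Σ[ M ∈ EdgeSet G ] (IsPerfectMatching G M × AntiForcingNumber G M k)

MinAntiForcing : ∀ {V} (G : Graph V) → ℕ → Set
MinAntiForcing G k =
  InAntiForcingSpectrum G k × (∀ j → InAntiForcingSpectrum G j → k ≤ j)

MaxAntiForcing : ∀ {V} (G : Graph V) → ℕ → Set
MaxAntiForcing G k =
  InAntiForcingSpectrum G k × (∀ j → InAntiForcingSpectrum G j → j ≤ k)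

data Vtx : Set where
  u v w z : ℕ → Vtx

G : ℕ → Graph Vtx
G n = record
  { vertices = u 0 ∷ v 0 ∷ concatMap (λ k → let i = suc k in u i ∷ v i ∷ w i ∷ z i ∷ []) (applyUpTo (λ k → k) (2 * n))
  ; edges =
         applyUpTo (λ k → (u k , u (suc k))) (2 * n)
      ++ applyUpTo (λ k → (v k , v (suc k))) (2 * n)
      ++ applyUpTo (λ k → (u k , v k)) (suc (2 * n))
      ++ applyUpTo (λ k → (w (suc k) , u (suc k))) (2 * n)
      ++ applyUpTo (λ k → (v (suc k) , z (suc k))) (2 * n)
      ++ applyUpTo (λ k → (w (1 + 2 * k) , w (2 + 2 * k))) n
      ++ applyUpTo (λ k → (z (1 + 2 * k) , z (2 + 2 * k))) n
  }

-- A perfect matching of G n is determined by the rung u₀v₀ and a chain of n blocks (the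
-- columns 2j+1, 2j+2 with their w- and z-squares), each matched locally in one of a few
-- ways (its type), compatibly with the edges entering from the left.
--
-- Upper bound: forbidding at most three suitable edges in every block leaves, sweeping from
-- right to left, the given matching as the only one, so af(G n, M) ≤ 3n.
-- Lower bound: for every block there is a perfect matching differing from M on one
-- alternating cycle near that block, and the new edges of these cycles can be labelled so
-- that different blocks get disjoint label classes. An anti-forcing set must contain a new
-- edge of every other perfect matching, hence af(G n, M) ≥ n.
-- Spectrum: the chains T…TAB…B and B…BF…F have anti-forcing numbers n + d (d < n) and
-- 2n + d (d ≤ n); the matching lower bounds use several labelled cycles per block.

module Submission where

open import Defs
open import Data.Bool using (Bool; true; false; _∧_; _∨_; not; if_then_else_)
import Data.Bool as B
open import Data.Empty using (⊥; ⊥-elim)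
open import Data.Fin using (Fin)
import Data.Fin as Fin
import Data.Fin.Properties as FP
open import Data.Fin.Subset using (Subset; ∣_∣)
import Data.Fin.Subset as FS
open import Data.List using (List; []; _∷_; _++_; map; applyUpTo; lookup; length; concatMap; filterᵇ)
open import Data.List.Properties using (map-++; map-applyUpTo; length-++; length-map)
import Data.List.Membership.Propositional as LM
open import Data.List.Membership.Propositional.Properties
open import Data.List.Relation.Unary.All as All using (All; []; _∷_)
import Data.List.Relation.Unary.All.Properties as AllP
open import Data.List.Relation.Unary.AllPairs using ([]; _∷_)
open import Data.List.Relation.Unary.Any as Any using (here; there)
open import Data.List.Relation.Unary.Any.Properties using (lookup-index)
open import Data.List.Relation.Unary.Unique.Propositional using (Unique)
import Data.List.Relation.Unary.Unique.Propositional.Properties as UP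
open import Data.List.Relation.Binary.Disjoint.Propositional using (Disjoint)
open import Data.Maybe using (Maybe; just; nothing; is-just)
open import Data.Nat using (ℕ; zero; suc; pred; ⌊_/2⌋; _≤ᵇ_; _+_; _∸_; _*_; _≤_; _<_; z≤n; s≤s; _<?_; _≤?_; _≟_)
open import Data.Nat.Properties
import Data.Nat as Nat
open import Data.Nat.Tactic.RingSolver
open import Data.Product using (Σ; Σ-syntax; ∃; _×_; _,_; proj₁; proj₂)
open import Data.Sum using (_⊎_; inj₁; inj₂)
open import Data.Unit using (⊤; tt)
open import Data.Vec as Vec using (Vec; []; _∷_)
open import Data.Vec.Properties using ([]=⇒lookup; lookup⇒[]=; lookup∘tabulate; tabulate∘lookup; tabulate-cong)
open import Function.Base using (_∘_)
open import Function.Bundles using (_⇔_; mk⇔; Equivalence)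
open import Data.Bool.Properties using (T-≡)
open import Data.Bool.ListAction using (all)
open import Relation.Nullary using (¬_; yes; no; Dec)
open import Relation.Nullary.Decidable using (_×-dec_; T?)
open import Relation.Binary using (tri<; tri≈; tri>)
open import Relation.Binary.PropositionalEquality

∧-projˡ : ∀ a {b} → a ∧ b ≡ true → a ≡ true
∧-projˡ true _ = refl

∧-projʳ : ∀ a {b} → a ∧ b ≡ true → b ≡ true
∧-projʳ true p = p

∧-intro : ∀ {a b} → a ≡ true → b ≡ true → a ∧ b ≡ true
∧-intro refl refl = refl

false⇒not-true : ∀ {b} → b ≡ false → not b ≡ true
false⇒not-true refl = refl

not-true⇒false : ∀ {b} → not b ≡ true → b ≡ false
not-true⇒false {false} _ = refl

true≢false : true ≢ false
true≢false ()

¬true⇒false : ∀ {b} → ¬ b ≡ true → b ≡ false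
¬true⇒false {true} h = ⊥-elim (h refl)
¬true⇒false {false} _ = refl

_⇒ᵇ_ : Bool → Bool → Bool
a ⇒ᵇ b = if a then b else true

⇒ᵇ-elim : ∀ {a b} → a ⇒ᵇ b ≡ true → a ≡ true → b ≡ true
⇒ᵇ-elim h refl = h

_≡ᵇ_ : Bool → Bool → Bool
true ≡ᵇ b = b
false ≡ᵇ b = not b

≡ᵇ-sound : ∀ a b → a ≡ᵇ b ≡ true → a ≡ b
≡ᵇ-sound true true _ = refl
≡ᵇ-sound false false _ = refl

≡ᵇ-complete : ∀ {a b} → a ≡ b → a ≡ᵇ b ≡ true
≡ᵇ-complete {true} refl = refl
≡ᵇ-complete {false} refl = refl

b2n : Bool → ℕ
b2n true = 1
b2n false = 0

all-sound : ∀ {A : Set} (f : A → Bool) {xs} → all f xs ≡ true → ∀ {x} → x LM.∈ xs → f x ≡ true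
all-sound f {y ∷ _} h (here refl) = ∧-projˡ (f y) h
all-sound f {y ∷ _} h (there p) = all-sound f (∧-projʳ (f y) h) p

all-complete : ∀ {A : Set} (f : A → Bool) xs → (∀ x → f x ≡ true) → all f xs ≡ true
all-complete f [] h = refl
all-complete f (x ∷ xs) h = ∧-intro (h x) (all-complete f xs h)

firstWith : ∀ {A : Set} → (A → Bool) → List A → Maybe A
firstWith p [] = nothing
firstWith p (x ∷ xs) = if p x then just x else firstWith p xs

firstWith-sound : ∀ {A : Set} (p : A → Bool) xs {x} → firstWith p xs ≡ just x → p x ≡ true
firstWith-sound p (y ∷ ys) h with p y in eq
... | true with h
...   | refl = eq
firstWith-sound p (y ∷ ys) h | false = firstWith-sound p ys h

allBools : (Bool → Bool) → Bool
allBools f = f false ∧ f true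

allBools-sound : ∀ f → allBools f ≡ true → ∀ b → f b ≡ true
allBools-sound f h false = ∧-projˡ (f false) h
allBools-sound f h true = ∧-projʳ (f false) h

allVecs : ∀ k → (Vec Bool k → Bool) → Bool
allVecs zero f = f []
allVecs (suc k) f = allBools λ b → allVecs k λ bs → f (b ∷ bs)

allVecs-sound : ∀ k f → allVecs k f ≡ true → ∀ bs → f bs ≡ true
allVecs-sound zero f h [] = h
allVecs-sound (suc k) f h (b ∷ bs) = allVecs-sound k (λ bs → f (b ∷ bs)) (allBools-sound (λ b → allVecs k λ bs → f (b ∷ bs)) h b) bs

-- Blocks and their local matchings

-- Block j (from 0) is formed by the columns a = 2j+1 and b = 2j+2. Its bits are the
-- edges u_a u_b (hu), v_a v_b (hv), the rungs u_a v_a (va) and u_b v_b (vb), w_a u_a (wa),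
-- w_b u_b (wb), w_a w_b (ww), v_a z_a (za), v_b z_b (zb), z_a z_b (zz), and the edges
-- u_{a-1} u_a (lu), v_{a-1} v_a (lv) entering the block from the left.
record Block : Set where
  constructor block
  field
    hu hv va vb wa wb ww za zb zz lu lv : Bool
open Block public

emptyBlock : Block
emptyBlock = block false false false false false false false false false false false false

data Slot : Set where
  pHu pHv pVa pVb pWa pWb pWW pZa pZb pZZ pLu pLv : Slot

bit : Block → Slot → Bool
bit x pHu = hu x
bit x pHv = hv x
bit x pVa = va x
bit x pVb = vb x
bit x pWa = wa x
bit x pWb = wb x
bit x pWW = ww x
bit x pZa = za x
bit x pZb = zb x
bit x pZZ = zz x
bit x pLu = lu x
bit x pLv = lv x

block-ext : ∀ {x y} → (∀ p → bit x p ≡ bit y p) → x ≡ y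
block-ext {block _ _ _ _ _ _ _ _ _ _ _ _} {block _ _ _ _ _ _ _ _ _ _ _ _} h
  with h pHu | h pHv | h pVa | h pVb | h pWa | h pWb | h pWW | h pZa | h pZb | h pZZ | h pLu | h pLv
... | refl | refl | refl | refl | refl | refl | refl | refl | refl | refl | refl | refl = refl

bit-emptyBlock : ∀ p → bit emptyBlock p ≡ false
bit-emptyBlock pHu = refl
bit-emptyBlock pHv = refl
bit-emptyBlock pVa = refl
bit-emptyBlock pVb = refl
bit-emptyBlock pWa = refl
bit-emptyBlock pWb = refl
bit-emptyBlock pWW = refl
bit-emptyBlock pZa = refl
bit-emptyBlock pZb = refl
bit-emptyBlock pZZ = refl
bit-emptyBlock pLu = refl
bit-emptyBlock pLv = refl

slots : List Slot
slots = pHu ∷ pHv ∷ pVa ∷ pVb ∷ pWa ∷ pWb ∷ pWW ∷ pZa ∷ pZb ∷ pZZ ∷ pLu ∷ pLv ∷ []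

allSlots : (Slot → Bool) → Bool
allSlots f = all f slots

∈-slots : ∀ p → p LM.∈ slots
∈-slots pHu = here refl
∈-slots pHv = there (here refl)
∈-slots pVa = there (there (here refl))
∈-slots pVb = there (there (there (here refl)))
∈-slots pWa = there (there (there (there (here refl))))
∈-slots pWb = there (there (there (there (there (here refl)))))
∈-slots pWW = there (there (there (there (there (there (here refl))))))
∈-slots pZa = there (there (there (there (there (there (there (here refl)))))))
∈-slots pZb = there (there (there (there (there (there (there (there (here refl))))))))
∈-slots pZZ = there (there (there (there (there (there (there (there (there (here refl)))))))))
∈-slots pLu = there (there (there (there (there (there (there (there (there (there (here refl))))))))))
∈-slots pLv = there (there (there (there (there (there (there (there (there (there (there (here refl)))))))))))

allSlots-sound : ∀ f → allSlots f ≡ true → ∀ p → f p ≡ true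
allSlots-sound f h p = all-sound f {slots} h (∈-slots p)

allSlots-complete : ∀ f → (∀ p → f p ≡ true) → allSlots f ≡ true
allSlots-complete f = all-complete f slots

_≡ᴮ_ : Block → Block → Bool
x ≡ᴮ y = allSlots λ p → bit x p ≡ᵇ bit y p

≡ᴮ-sound : ∀ x y → x ≡ᴮ y ≡ true → x ≡ y
≡ᴮ-sound x y h = block-ext λ p → ≡ᵇ-sound (bit x p) (bit y p) (allSlots-sound (λ p → bit x p ≡ᵇ bit y p) h p)

fromVec : Vec Bool 12 → Block
fromVec (a1 ∷ a2 ∷ a3 ∷ a4 ∷ a5 ∷ a6 ∷ a7 ∷ a8 ∷ a9 ∷ a10 ∷ a11 ∷ a12 ∷ []) =
  block a1 a2 a3 a4 a5 a6 a7 a8 a9 a10 a11 a12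

toVec : Block → Vec Bool 12
toVec x = hu x ∷ hv x ∷ va x ∷ vb x ∷ wa x ∷ wb x ∷ ww x ∷ za x ∷ zb x ∷ zz x ∷ lu x ∷ lv x ∷ []

allBlocks : (Block → Bool) → Bool
allBlocks f = allVecs 12 λ bs → f (fromVec bs)

allBlocks-sound : ∀ f → allBlocks f ≡ true → ∀ x → f x ≡ true
allBlocks-sound f h x = allVecs-sound 12 (λ bs → f (fromVec bs)) h (toVec x)

disjointᵇ : Block → Block → Bool
disjointᵇ m x = allSlots λ p → not (bit m p ∧ bit x p)

selected : Block → List Slot
selected x = filterᵇ (bit x) slots

∈-selected : ∀ x p → bit x p ≡ true → p LM.∈ selected x
∈-selected x p t = ∈-filter⁺ (T? ∘ bit x) (∈-slots p) (Equivalence.from T-≡ t)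

size : Block → ℕ
size x = length (selected x)

none : List Bool → Bool
none [] = true
none (true ∷ _) = false
none (false ∷ bs) = none bs

exactlyOne : List Bool → Bool
exactlyOne [] = false
exactlyOne (true ∷ bs) = none bs
exactlyOne (false ∷ bs) = exactlyOne bs

-- r1 and r2 are the edges u_b u_{b+1} and v_b v_{b+1} leaving the block to the right.
isLocalMatching : Block → Bool → Bool → Bool
isLocalMatching x r1 r2 =
  exactlyOne (lu x ∷ hu x ∷ va x ∷ wa x ∷ []) ∧ exactlyOne (lv x ∷ hv x ∷ va x ∷ za x ∷ []) ∧
  exactlyOne (hu x ∷ r1 ∷ vb x ∷ wb x ∷ []) ∧ exactlyOne (hv x ∷ r2 ∷ vb x ∷ zb x ∷ []) ∧
  exactlyOne (wa x ∷ ww x ∷ []) ∧ exactlyOne (wb x ∷ ww x ∷ []) ∧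
  exactlyOne (za x ∷ zz x ∷ []) ∧ exactlyOne (zb x ∷ zz x ∷ [])

module _ (x : Block) (r1 r2 : Bool) (h : isLocalMatching x r1 r2 ≡ true) where

  private
    rest₁ = ∧-projʳ (exactlyOne (lu x ∷ hu x ∷ va x ∷ wa x ∷ [])) h
    rest₂ = ∧-projʳ (exactlyOne (lv x ∷ hv x ∷ va x ∷ za x ∷ [])) rest₁
    rest₃ = ∧-projʳ (exactlyOne (hu x ∷ r1 ∷ vb x ∷ wb x ∷ [])) rest₂
    rest₄ = ∧-projʳ (exactlyOne (hv x ∷ r2 ∷ vb x ∷ zb x ∷ [])) rest₃
    rest₅ = ∧-projʳ (exactlyOne (wa x ∷ ww x ∷ [])) rest₄
    rest₆ = ∧-projʳ (exactlyOne (wb x ∷ ww x ∷ [])) rest₅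
    rest₇ = ∧-projʳ (exactlyOne (za x ∷ zz x ∷ [])) rest₆

  covers-ua : exactlyOne (lu x ∷ hu x ∷ va x ∷ wa x ∷ []) ≡ true
  covers-ua = ∧-projˡ _ h
  covers-va : exactlyOne (lv x ∷ hv x ∷ va x ∷ za x ∷ []) ≡ true
  covers-va = ∧-projˡ _ rest₁
  covers-ub : exactlyOne (hu x ∷ r1 ∷ vb x ∷ wb x ∷ []) ≡ true
  covers-ub = ∧-projˡ _ rest₂
  covers-vb : exactlyOne (hv x ∷ r2 ∷ vb x ∷ zb x ∷ []) ≡ true
  covers-vb = ∧-projˡ _ rest₃
  covers-wa : exactlyOne (wa x ∷ ww x ∷ []) ≡ true
  covers-wa = ∧-projˡ _ rest₄
  covers-wb : exactlyOne (wb x ∷ ww x ∷ []) ≡ true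
  covers-wb = ∧-projˡ _ rest₅
  covers-za : exactlyOne (za x ∷ zz x ∷ []) ≡ true
  covers-za = ∧-projˡ _ rest₆
  covers-zb : exactlyOne (zb x ∷ zz x ∷ []) ≡ true
  covers-zb = rest₇

isLocalMatching-intro : ∀ x r1 r2 →
  exactlyOne (lu x ∷ hu x ∷ va x ∷ wa x ∷ []) ≡ true → exactlyOne (lv x ∷ hv x ∷ va x ∷ za x ∷ []) ≡ true →
  exactlyOne (hu x ∷ r1 ∷ vb x ∷ wb x ∷ []) ≡ true → exactlyOne (hv x ∷ r2 ∷ vb x ∷ zb x ∷ []) ≡ true →
  exactlyOne (wa x ∷ ww x ∷ []) ≡ true → exactlyOne (wb x ∷ ww x ∷ []) ≡ true →
  exactlyOne (za x ∷ zz x ∷ []) ≡ true → exactlyOne (zb x ∷ zz x ∷ []) ≡ true →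
  isLocalMatching x r1 r2 ≡ true
isLocalMatching-intro x r1 r2 h1 h2 h3 h4 h5 h6 h7 h8 =
  ∧-intro h1 (∧-intro h2 (∧-intro h3 (∧-intro h4 (∧-intro h5 (∧-intro h6 (∧-intro h7 h8))))))

-- All local matchings of a block (checked exhaustively by classify below), written as
-- their blocks and right exits. The four types oT… enter the block through exactly one
-- of the two left edges, which never happens in a perfect matching of G n.
data BlockType : Set where
  cT cA cG cB cC cD cE cF oTu1 oTv1 oTu2 oTv2 : BlockType

shape : BlockType → Block
shape cT = block false false false false false false true false false true true true
shape cA = block false false false true false false true false false true true true
shape cG = block false false true false false false true false false true false false
shape cB = block false false false false true true false true true false false false
shape cC = block false true false false true true false false false true false false
shape cD = block true false false false false false true true true false false false
shape cE = block false false true true false false true false false true false false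
shape cF = block true true false false false false true false false true false false
shape oTu1 = block false false false false false false true true true false true false
shape oTv1 = block false false false false true true false false false true false true
shape oTu2 = block false true false false false false true false false true true false
shape oTv2 = block true false false false false false true false false true false true

exitU exitV : BlockType → Bool
exitU cT = true
exitU cG = true
exitU oTu1 = true
exitU oTu2 = true
exitU _ = false
exitV cT = true
exitV cG = true
exitV oTv1 = true
exitV oTv2 = true
exitV _ = false

allTypes : List BlockType
allTypes = cT ∷ cA ∷ cG ∷ cB ∷ cC ∷ cD ∷ cE ∷ cF ∷ oTu1 ∷ oTv1 ∷ oTu2 ∷ oTv2 ∷ []

allTypesᵇ : (BlockType → Bool) → Bool
allTypesᵇ f = all f allTypes

∈-allTypes : ∀ c → c LM.∈ allTypes
∈-allTypes cT = here refl
∈-allTypes cA = there (here refl)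
∈-allTypes cG = there (there (here refl))
∈-allTypes cB = there (there (there (here refl)))
∈-allTypes cC = there (there (there (there (here refl))))
∈-allTypes cD = there (there (there (there (there (here refl)))))
∈-allTypes cE = there (there (there (there (there (there (here refl))))))
∈-allTypes cF = there (there (there (there (there (there (there (here refl)))))))
∈-allTypes oTu1 = there (there (there (there (there (there (there (there (here refl))))))))
∈-allTypes oTv1 = there (there (there (there (there (there (there (there (there (here refl)))))))))
∈-allTypes oTu2 = there (there (there (there (there (there (there (there (there (there (here refl))))))))))
∈-allTypes oTv2 = there (there (there (there (there (there (there (there (there (there (there (here refl)))))))))))

allTypes-sound : ∀ f → allTypesᵇ f ≡ true → ∀ c → f c ≡ true
allTypes-sound f h c = all-sound f {allTypes} h (∈-allTypes c)

allPairsᵇ : (BlockType → BlockType → Bool) → Bool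
allPairsᵇ f = allTypesᵇ λ c → allTypesᵇ (f c)

allPairs-sound : ∀ f → allPairsᵇ f ≡ true → ∀ c d → f c d ≡ true
allPairs-sound f h c d = allTypes-sound (f c) (allTypes-sound (λ c → allTypesᵇ (f c)) h c) d

typeOf : Block → Maybe BlockType
typeOf x = firstWith (λ c → shape c ≡ᴮ x) allTypes

fits : Block → Bool → Bool → BlockType → Bool
fits x r1 r2 c = (shape c ≡ᴮ x) ∧ (exitU c ≡ᵇ r1) ∧ (exitV c ≡ᵇ r2)

-- Opaque: unfolding findType on a block with unknown bits exhausts memory during type checking.
opaque
  findType : Block → Bool → Bool → Maybe BlockType
  findType x r1 r2 = firstWith (fits x r1 r2) allTypes

opaque
  unfolding findType

  findType-sound : ∀ x r1 r2 {c} → findType x r1 r2 ≡ just c → (shape c ≡ x) × (exitU c ≡ r1) × (exitV c ≡ r2)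
  findType-sound x r1 r2 {c} h =
    ≡ᴮ-sound _ _ (∧-projˡ _ fit) ,
    ≡ᵇ-sound _ _ (∧-projˡ _ (∧-projʳ (shape c ≡ᴮ x) fit)) ,
    ≡ᵇ-sound _ _ (∧-projʳ (exitU c ≡ᵇ r1) (∧-projʳ (shape c ≡ᴮ x) fit))
    where
    fit : fits x r1 r2 c ≡ true
    fit = firstWith-sound (fits x r1 r2) allTypes h

  findType-shape : ∀ c → findType (shape c) (exitU c) (exitV c) ≡ just c
  findType-shape cT = refl
  findType-shape cA = refl
  findType-shape cG = refl
  findType-shape cB = refl
  findType-shape cC = refl
  findType-shape cD = refl
  findType-shape cE = refl
  findType-shape cF = refl
  findType-shape oTu1 = refl
  findType-shape oTv1 = refl
  findType-shape oTu2 = refl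
  findType-shape oTv2 = refl

  typeable : Block → Bool
  typeable x = allBools λ r1 → allBools λ r2 → isLocalMatching x r1 r2 ⇒ᵇ is-just (findType x r1 r2)

  every-block-typeable : allBlocks typeable ≡ true
  every-block-typeable = refl

  every-local-matching-typed : ∀ x r1 r2 → isLocalMatching x r1 r2 ⇒ᵇ is-just (findType x r1 r2) ≡ true
  every-local-matching-typed x r1 r2 =
    allBools-sound (λ r2 → isLocalMatching x r1 r2 ⇒ᵇ is-just (findType x r1 r2))
      (allBools-sound (λ r1 → allBools λ r2 → isLocalMatching x r1 r2 ⇒ᵇ is-just (findType x r1 r2))
        (allBlocks-sound typeable every-block-typeable x) r1) r2

classify : ∀ x r1 r2 → isLocalMatching x r1 r2 ≡ true →
  Σ BlockType λ c → (findType x r1 r2 ≡ just c) × (shape c ≡ x) × (exitU c ≡ r1) × (exitV c ≡ r2)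
classify x r1 r2 h = typed (findType x r1 r2) refl (⇒ᵇ-elim (every-local-matching-typed x r1 r2) h)
  where
  typed : ∀ m → findType x r1 r2 ≡ m → is-just m ≡ true →
    Σ BlockType λ c → (findType x r1 r2 ≡ just c) × (shape c ≡ x) × (exitU c ≡ r1) × (exitV c ≡ r2)
  typed (just c) eq _ = c , eq , findType-sound x r1 r2 eq

-- The edges to forbid in a block of type c: they leave c as its only local matching with
-- the same right exits.
forcer : BlockType → Block
forcer cT = block false false true false false false false false false false false false
forcer cA = block true false true false true false false false false false false false
forcer cG = block false false false false false false false false false false true false
forcer cB = block true false false false false false false false false true false false
forcer cC = block false false false false false false true true false false false false
forcer cD = block false false false false true false false false false true false false
forcer cE = block true false false false true false false false false false true false
forcer cF = block false false false true true false false true false false false false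
forcer oTu1 = block false true false false false false false false false false false false
forcer oTv1 = block true false false false false false false false false false false false
forcer oTu2 = block false false false false false false false true false false false false
forcer oTv2 = block false false false false true false false false false false false false

forcer-forces : ∀ c d → exitU c ≡ exitU d → exitV c ≡ exitV d → disjointᵇ (forcer c) (shape d) ≡ true →
  shape d ≡ shape c
forcer-forces c d e1 e2 e3 = ≡ᴮ-sound _ _ (⇒ᵇ-elim (allPairs-sound check refl c d)
  (∧-intro (≡ᵇ-complete e1) (∧-intro (≡ᵇ-complete e2) e3)))
  where
  check : BlockType → BlockType → Bool
  check c d = ((exitU c ≡ᵇ exitU d) ∧ (exitV c ≡ᵇ exitV d) ∧ disjointᵇ (forcer c) (shape d)) ⇒ᵇ (shape d ≡ᴮ shape c)

forcer-avoids : ∀ c → disjointᵇ (forcer c) (shape c) ≡ true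
forcer-avoids = allTypes-sound (λ c → disjointᵇ (forcer c) (shape c)) refl

size-forcer≤3 : ∀ c → size (forcer c) ≤ 3
size-forcer≤3 c = ≤ᵇ⇒≤ (size (forcer c)) 3 (Equivalence.from T-≡ (allTypes-sound (λ c → size (forcer c) ≤ᵇ 3) refl c))

balanced-exits : ∀ c → lu (shape c) ≡ lv (shape c) → exitU c ≡ exitV c
balanced-exits c e = ≡ᵇ-sound _ _ (⇒ᵇ-elim (allTypes-sound check refl c) (≡ᵇ-complete e))
  where
  check : BlockType → Bool
  check c = (lu (shape c) ≡ᵇ lv (shape c)) ⇒ᵇ (exitU c ≡ᵇ exitV c)

rung-b : Block
rung-b = block false false false true false false false false false false false false

rung-b-forces-cT : ∀ d → lu (shape d) ≡ true → lv (shape d) ≡ true → disjointᵇ rung-b (shape d) ≡ true →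
  (shape d ≡ shape cT) × (exitU d ≡ true) × (exitV d ≡ true)
rung-b-forces-cT d e1 e2 e3 =
  ≡ᴮ-sound _ _ (∧-projˡ _ h) , ∧-projˡ _ (∧-projʳ (shape d ≡ᴮ shape cT) h) , ∧-projʳ (exitU d) (∧-projʳ (shape d ≡ᴮ shape cT) h)
  where
  check : BlockType → Bool
  check d = (lu (shape d) ∧ lv (shape d) ∧ disjointᵇ rung-b (shape d)) ⇒ᵇ ((shape d ≡ᴮ shape cT) ∧ exitU d ∧ exitV d)
  h = ⇒ᵇ-elim (allTypes-sound check refl d) (∧-intro e1 (∧-intro e2 e3))

enclosed-is-cA : ∀ d → lu (shape d) ≡ true → lv (shape d) ≡ true → exitU d ≡ false → exitV d ≡ false →
  shape d ≡ shape cA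
enclosed-is-cA d e1 e2 e3 e4 =
  ≡ᴮ-sound _ _ (⇒ᵇ-elim (allTypes-sound check refl d) (∧-intro e1 (∧-intro e2 (∧-intro (false⇒not-true e3) (false⇒not-true e4)))))
  where
  check : BlockType → Bool
  check d = (lu (shape d) ∧ lv (shape d) ∧ not (exitU d) ∧ not (exitV d)) ⇒ᵇ (shape d ≡ᴮ shape cA)

-- Edges of G n

dbl : ℕ → ℕ
dbl zero = zero
dbl (suc j) = suc (suc (dbl j))

odd : ℕ → Bool
odd zero = false
odd (suc zero) = true
odd (suc (suc k)) = odd k

⌊dbl/2⌋≡ : ∀ j → ⌊ dbl j /2⌋ ≡ j
⌊dbl/2⌋≡ zero = refl
⌊dbl/2⌋≡ (suc j) = cong suc (⌊dbl/2⌋≡ j)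

⌊suc-dbl/2⌋≡ : ∀ j → ⌊ suc (dbl j) /2⌋ ≡ j
⌊suc-dbl/2⌋≡ zero = refl
⌊suc-dbl/2⌋≡ (suc j) = cong suc (⌊suc-dbl/2⌋≡ j)

odd-dbl : ∀ j → odd (dbl j) ≡ false
odd-dbl zero = refl
odd-dbl (suc j) = odd-dbl j

odd-sdbl : ∀ j → odd (suc (dbl j)) ≡ true
odd-sdbl zero = refl
odd-sdbl (suc j) = odd-sdbl j

data Parity : ℕ → Set where
  evenᵖ : ∀ j → Parity (dbl j)
  oddᵖ : ∀ j → Parity (suc (dbl j))

parity : ∀ k → Parity k
parity zero = evenᵖ zero
parity (suc zero) = oddᵖ zero
parity (suc (suc k)) with parity k
... | evenᵖ j = evenᵖ (suc j)
... | oddᵖ j = oddᵖ (suc j)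

2*≡dbl : ∀ n → 2 * n ≡ dbl n
2*≡dbl zero = refl
2*≡dbl (suc n) = trans (cong suc (+-suc n (n + 0))) (cong (λ t → suc (suc t)) (2*≡dbl n))

dbl-mono-< : ∀ {j n} → j < n → dbl j < dbl n
dbl-mono-< {zero} {suc n} _ = s≤s z≤n
dbl-mono-< {suc j} {suc n} (s≤s p) = s≤s (s≤s (dbl-mono-< p))

suc-dbl<dbl : ∀ {j n} → j < n → suc (dbl j) < dbl n
suc-dbl<dbl {zero} {suc n} _ = s≤s (s≤s z≤n)
suc-dbl<dbl {suc j} {suc n} (s≤s p) = s≤s (s≤s (suc-dbl<dbl p))

dbl-cancel-< : ∀ {j n} → dbl j < dbl n → j < n
dbl-cancel-< {zero} {suc n} _ = s≤s z≤n
dbl-cancel-< {zero} {zero} ()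
dbl-cancel-< {suc j} {suc n} (s≤s (s≤s p)) = s≤s (dbl-cancel-< p)

suc-dbl-cancel-< : ∀ {j n} → suc (dbl j) < dbl n → j < n
suc-dbl-cancel-< {j} {n} p = dbl-cancel-< (<-trans (n<1+n (dbl j)) p)

suc-suc-dbl-cancel-< : ∀ {j n} → suc (suc (dbl j)) < suc (dbl n) → j < n
suc-suc-dbl-cancel-< {j} {n} (s≤s p) = suc-dbl-cancel-< p

data Edge : Set where
  eHu eHv eVt eWu eVz eWw eZz : ℕ → Edge

ends : Edge → Vtx × Vtx
ends (eHu k) = u k , u (suc k)
ends (eHv k) = v k , v (suc k)
ends (eVt k) = u k , v k
ends (eWu k) = w (suc k) , u (suc k)
ends (eVz k) = v (suc k) , z (suc k)
ends (eWw k) = w (1 + 2 * k) , w (2 + 2 * k)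
ends (eZz k) = z (1 + 2 * k) , z (2 + 2 * k)

edgeWithEnds : Vtx × Vtx → Edge
edgeWithEnds (u k , u _) = eHu k
edgeWithEnds (v k , v _) = eHv k
edgeWithEnds (u k , v _) = eVt k
edgeWithEnds (w _ , u m) = eWu (pred m)
edgeWithEnds (v _ , z m) = eVz (pred m)
edgeWithEnds (w a , w _) = eWw ⌊ pred a /2⌋
edgeWithEnds (z a , z _) = eZz ⌊ pred a /2⌋
edgeWithEnds _ = eVt 0

⌊2*/2⌋≡ : ∀ k → ⌊ 2 * k /2⌋ ≡ k
⌊2*/2⌋≡ k rewrite 2*≡dbl k = ⌊dbl/2⌋≡ k

edgeWithEnds-ends : ∀ e → edgeWithEnds (ends e) ≡ e
edgeWithEnds-ends (eHu k) = refl
edgeWithEnds-ends (eHv k) = refl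
edgeWithEnds-ends (eVt k) = refl
edgeWithEnds-ends (eWu k) = refl
edgeWithEnds-ends (eVz k) = refl
edgeWithEnds-ends (eWw k) = cong eWw (⌊2*/2⌋≡ k)
edgeWithEnds-ends (eZz k) = cong eZz (⌊2*/2⌋≡ k)

ends-injective : ∀ {e e'} → ends e ≡ ends e' → e ≡ e'
ends-injective {e} {e'} eq = trans (sym (edgeWithEnds-ends e)) (trans (cong edgeWithEnds eq) (edgeWithEnds-ends e'))

edgeList : ℕ → List Edge
edgeList n = applyUpTo eHu (2 * n) ++ applyUpTo eHv (2 * n) ++ applyUpTo eVt (suc (2 * n)) ++
        applyUpTo eWu (2 * n) ++ applyUpTo eVz (2 * n) ++ applyUpTo eWw n ++ applyUpTo eZz n

map-ends-++ : ∀ (xs ys : List Edge) xs' ys' → map ends xs ≡ xs' → map ends ys ≡ ys' → map ends (xs ++ ys) ≡ xs' ++ ys'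
map-ends-++ xs ys xs' ys' p q = trans (map-++ ends xs ys) (cong₂ _++_ p q)

edges≡map-ends : ∀ n → edges (G n) ≡ map ends (edgeList n)
edges≡map-ends n = sym
  (map-ends-++ (applyUpTo eHu (2 * n)) _ (applyUpTo (λ k → (u k , u (suc k))) (2 * n)) _ (map-applyUpTo eHu ends (2 * n))
  (map-ends-++ (applyUpTo eHv (2 * n)) _ (applyUpTo (λ k → (v k , v (suc k))) (2 * n)) _ (map-applyUpTo eHv ends (2 * n))
  (map-ends-++ (applyUpTo eVt (suc (2 * n))) _ (applyUpTo (λ k → (u k , v k)) (suc (2 * n))) _ (map-applyUpTo eVt ends (suc (2 * n)))
  (map-ends-++ (applyUpTo eWu (2 * n)) _ (applyUpTo (λ k → (w (suc k) , u (suc k))) (2 * n)) _ (map-applyUpTo eWu ends (2 * n))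
  (map-ends-++ (applyUpTo eVz (2 * n)) _ (applyUpTo (λ k → (v (suc k) , z (suc k))) (2 * n)) _ (map-applyUpTo eVz ends (2 * n))
  (map-ends-++ (applyUpTo eWw n) (applyUpTo eZz n) (applyUpTo (λ k → (w (1 + 2 * k) , w (2 + 2 * k))) n)
       (applyUpTo (λ k → (z (1 + 2 * k) , z (2 + 2 * k))) n)
       (map-applyUpTo eWw ends n) (map-applyUpTo eZz ends n)))))))

data Loc : Set where
  L0 : Loc
  LC : ℕ → Slot → Loc

locOf : Edge → Loc
locOf (eHu k) = if odd k then LC ⌊ k /2⌋ pHu else LC ⌊ k /2⌋ pLu
locOf (eHv k) = if odd k then LC ⌊ k /2⌋ pHv else LC ⌊ k /2⌋ pLv
locOf (eVt zero) = L0
locOf (eVt (suc k)) = if odd k then LC ⌊ k /2⌋ pVb else LC ⌊ k /2⌋ pVa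
locOf (eWu k) = if odd k then LC ⌊ k /2⌋ pWb else LC ⌊ k /2⌋ pWa
locOf (eVz k) = if odd k then LC ⌊ k /2⌋ pZb else LC ⌊ k /2⌋ pZa
locOf (eWw j) = LC j pWW
locOf (eZz j) = LC j pZZ

edgeAt : Loc → Edge
edgeAt L0 = eVt 0
edgeAt (LC j pHu) = eHu (suc (dbl j))
edgeAt (LC j pHv) = eHv (suc (dbl j))
edgeAt (LC j pVa) = eVt (suc (dbl j))
edgeAt (LC j pVb) = eVt (suc (suc (dbl j)))
edgeAt (LC j pWa) = eWu (dbl j)
edgeAt (LC j pWb) = eWu (suc (dbl j))
edgeAt (LC j pWW) = eWw j
edgeAt (LC j pZa) = eVz (dbl j)
edgeAt (LC j pZb) = eVz (suc (dbl j))
edgeAt (LC j pZZ) = eZz j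
edgeAt (LC j pLu) = eHu (dbl j)
edgeAt (LC j pLv) = eHv (dbl j)

locOf-edgeAt : ∀ l → locOf (edgeAt l) ≡ l
locOf-edgeAt L0 = refl
locOf-edgeAt (LC j pHu) rewrite odd-sdbl j | ⌊suc-dbl/2⌋≡ j = refl
locOf-edgeAt (LC j pHv) rewrite odd-sdbl j | ⌊suc-dbl/2⌋≡ j = refl
locOf-edgeAt (LC j pVa) rewrite odd-dbl j | ⌊dbl/2⌋≡ j = refl
locOf-edgeAt (LC j pVb) rewrite odd-sdbl j | ⌊suc-dbl/2⌋≡ j = refl
locOf-edgeAt (LC j pWa) rewrite odd-dbl j | ⌊dbl/2⌋≡ j = refl
locOf-edgeAt (LC j pWb) rewrite odd-sdbl j | ⌊suc-dbl/2⌋≡ j = refl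
locOf-edgeAt (LC j pWW) = refl
locOf-edgeAt (LC j pZa) rewrite odd-dbl j | ⌊dbl/2⌋≡ j = refl
locOf-edgeAt (LC j pZb) rewrite odd-sdbl j | ⌊suc-dbl/2⌋≡ j = refl
locOf-edgeAt (LC j pZZ) = refl
locOf-edgeAt (LC j pLu) rewrite odd-dbl j | ⌊dbl/2⌋≡ j = refl
locOf-edgeAt (LC j pLv) rewrite odd-dbl j | ⌊dbl/2⌋≡ j = refl

edgeAt-locOf : ∀ e → edgeAt (locOf e) ≡ e
edgeAt-locOf (eHu k) with parity k
... | evenᵖ j rewrite odd-dbl j | ⌊dbl/2⌋≡ j = refl
... | oddᵖ j rewrite odd-sdbl j | ⌊suc-dbl/2⌋≡ j = refl
edgeAt-locOf (eHv k) with parity k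
... | evenᵖ j rewrite odd-dbl j | ⌊dbl/2⌋≡ j = refl
... | oddᵖ j rewrite odd-sdbl j | ⌊suc-dbl/2⌋≡ j = refl
edgeAt-locOf (eVt zero) = refl
edgeAt-locOf (eVt (suc k)) with parity k
... | evenᵖ j rewrite odd-dbl j | ⌊dbl/2⌋≡ j = refl
... | oddᵖ j rewrite odd-sdbl j | ⌊suc-dbl/2⌋≡ j = refl
edgeAt-locOf (eWu k) with parity k
... | evenᵖ j rewrite odd-dbl j | ⌊dbl/2⌋≡ j = refl
... | oddᵖ j rewrite odd-sdbl j | ⌊suc-dbl/2⌋≡ j = refl
edgeAt-locOf (eVz k) with parity k
... | evenᵖ j rewrite odd-dbl j | ⌊dbl/2⌋≡ j = refl
... | oddᵖ j rewrite odd-sdbl j | ⌊suc-dbl/2⌋≡ j = refl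
edgeAt-locOf (eWw j) = refl
edgeAt-locOf (eZz j) = refl

InRange : ℕ → Edge → Set
InRange n (eHu k) = k < dbl n
InRange n (eHv k) = k < dbl n
InRange n (eVt k) = k < suc (dbl n)
InRange n (eWu k) = k < dbl n
InRange n (eVz k) = k < dbl n
InRange n (eWw k) = k < n
InRange n (eZz k) = k < n

inRange? : ∀ n e → Dec (InRange n e)
inRange? n (eHu k) = k <? dbl n
inRange? n (eHv k) = k <? dbl n
inRange? n (eVt k) = k <? suc (dbl n)
inRange? n (eWu k) = k <? dbl n
inRange? n (eVz k) = k <? dbl n
inRange? n (eWw k) = k <? n
inRange? n (eZz k) = k <? n

LocInRange : ℕ → Loc → Set
LocInRange n L0 = ⊤
LocInRange n (LC j p) = j < n

locInRange⇒inRange : ∀ n l → LocInRange n l → InRange n (edgeAt l)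
locInRange⇒inRange n L0 _ = s≤s z≤n
locInRange⇒inRange n (LC j pHu) h = suc-dbl<dbl h
locInRange⇒inRange n (LC j pHv) h = suc-dbl<dbl h
locInRange⇒inRange n (LC j pVa) h = s≤s (dbl-mono-< h)
locInRange⇒inRange n (LC j pVb) h = s≤s (suc-dbl<dbl h)
locInRange⇒inRange n (LC j pWa) h = dbl-mono-< h
locInRange⇒inRange n (LC j pWb) h = suc-dbl<dbl h
locInRange⇒inRange n (LC j pWW) h = h
locInRange⇒inRange n (LC j pZa) h = dbl-mono-< h
locInRange⇒inRange n (LC j pZb) h = suc-dbl<dbl h
locInRange⇒inRange n (LC j pZZ) h = h
locInRange⇒inRange n (LC j pLu) h = dbl-mono-< h
locInRange⇒inRange n (LC j pLv) h = dbl-mono-< h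

inRange⇒locInRange : ∀ n e → InRange n e → LocInRange n (locOf e)
inRange⇒locInRange n e h = locate (locOf e) (subst (InRange n) (sym (edgeAt-locOf e)) h)
  where
  locate : ∀ l → InRange n (edgeAt l) → LocInRange n l
  locate L0 _ = tt
  locate (LC j pHu) h = suc-dbl-cancel-< h
  locate (LC j pHv) h = suc-dbl-cancel-< h
  locate (LC j pVa) h = dbl-cancel-< (≤-pred h)
  locate (LC j pVb) h = suc-suc-dbl-cancel-< h
  locate (LC j pWa) h = dbl-cancel-< h
  locate (LC j pWb) h = suc-dbl-cancel-< h
  locate (LC j pWW) h = h
  locate (LC j pZa) h = dbl-cancel-< h
  locate (LC j pZb) h = suc-dbl-cancel-< h
  locate (LC j pZZ) h = h
  locate (LC j pLu) h = dbl-cancel-< h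
  locate (LC j pLv) h = dbl-cancel-< h

∈edgeList⇒inRange : ∀ n e → e LM.∈ edgeList n → InRange n e
∈edgeList⇒inRange n e m0 with ∈-++⁻ (applyUpTo eHu (2 * n)) m0
... | inj₁ p with ∈-applyUpTo⁻ eHu p
...   | k , k< , refl = subst (k <_) (2*≡dbl n) k<
∈edgeList⇒inRange n e m0 | inj₂ m1 with ∈-++⁻ (applyUpTo eHv (2 * n)) m1
... | inj₁ p with ∈-applyUpTo⁻ eHv p
...   | k , k< , refl = subst (k <_) (2*≡dbl n) k<
∈edgeList⇒inRange n e m0 | inj₂ m1 | inj₂ m2 with ∈-++⁻ (applyUpTo eVt (suc (2 * n))) m2
... | inj₁ p with ∈-applyUpTo⁻ eVt p
...   | k , k< , refl = subst (λ t → k < suc t) (2*≡dbl n) k<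
∈edgeList⇒inRange n e m0 | inj₂ m1 | inj₂ m2 | inj₂ m3 with ∈-++⁻ (applyUpTo eWu (2 * n)) m3
... | inj₁ p with ∈-applyUpTo⁻ eWu p
...   | k , k< , refl = subst (k <_) (2*≡dbl n) k<
∈edgeList⇒inRange n e m0 | inj₂ m1 | inj₂ m2 | inj₂ m3 | inj₂ m4 with ∈-++⁻ (applyUpTo eVz (2 * n)) m4
... | inj₁ p with ∈-applyUpTo⁻ eVz p
...   | k , k< , refl = subst (k <_) (2*≡dbl n) k<
∈edgeList⇒inRange n e m0 | inj₂ m1 | inj₂ m2 | inj₂ m3 | inj₂ m4 | inj₂ m5 with ∈-++⁻ (applyUpTo eWw n) m5
... | inj₁ p with ∈-applyUpTo⁻ eWw p
...   | k , k< , refl = k<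
∈edgeList⇒inRange n e m0 | inj₂ m1 | inj₂ m2 | inj₂ m3 | inj₂ m4 | inj₂ m5 | inj₂ p with ∈-applyUpTo⁻ eZz p
...   | k , k< , refl = k<

inRange⇒∈edgeList : ∀ n e → InRange n e → e LM.∈ edgeList n
inRange⇒∈edgeList n (eHu k) h = ∈-++⁺ˡ (∈-applyUpTo⁺ eHu (subst (k <_) (sym (2*≡dbl n)) h))
inRange⇒∈edgeList n (eHv k) h = ∈-++⁺ʳ (applyUpTo eHu (2 * n)) (∈-++⁺ˡ (∈-applyUpTo⁺ eHv (subst (k <_) (sym (2*≡dbl n)) h)))
inRange⇒∈edgeList n (eVt k) h = ∈-++⁺ʳ (applyUpTo eHu (2 * n)) (∈-++⁺ʳ (applyUpTo eHv (2 * n))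
  (∈-++⁺ˡ (∈-applyUpTo⁺ eVt (subst (λ t → k < suc t) (sym (2*≡dbl n)) h))))
inRange⇒∈edgeList n (eWu k) h = ∈-++⁺ʳ (applyUpTo eHu (2 * n)) (∈-++⁺ʳ (applyUpTo eHv (2 * n))
  (∈-++⁺ʳ (applyUpTo eVt (suc (2 * n))) (∈-++⁺ˡ (∈-applyUpTo⁺ eWu (subst (k <_) (sym (2*≡dbl n)) h)))))
inRange⇒∈edgeList n (eVz k) h = ∈-++⁺ʳ (applyUpTo eHu (2 * n)) (∈-++⁺ʳ (applyUpTo eHv (2 * n))
  (∈-++⁺ʳ (applyUpTo eVt (suc (2 * n))) (∈-++⁺ʳ (applyUpTo eWu (2 * n))
  (∈-++⁺ˡ (∈-applyUpTo⁺ eVz (subst (k <_) (sym (2*≡dbl n)) h))))))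
inRange⇒∈edgeList n (eWw k) h = ∈-++⁺ʳ (applyUpTo eHu (2 * n)) (∈-++⁺ʳ (applyUpTo eHv (2 * n))
  (∈-++⁺ʳ (applyUpTo eVt (suc (2 * n))) (∈-++⁺ʳ (applyUpTo eWu (2 * n))
  (∈-++⁺ʳ (applyUpTo eVz (2 * n)) (∈-++⁺ˡ (∈-applyUpTo⁺ eWw h))))))
inRange⇒∈edgeList n (eZz k) h = ∈-++⁺ʳ (applyUpTo eHu (2 * n)) (∈-++⁺ʳ (applyUpTo eHv (2 * n))
  (∈-++⁺ʳ (applyUpTo eVt (suc (2 * n))) (∈-++⁺ʳ (applyUpTo eWu (2 * n))
  (∈-++⁺ʳ (applyUpTo eVz (2 * n)) (∈-++⁺ʳ (applyUpTo eWw n) (∈-applyUpTo⁺ eZz h))))))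

-- c0 is the rung u₀v₀. Blocks from n on are empty, so the last block has no right exits.
record IsChain (n : ℕ) (c0 : Bool) (cl : ℕ → Block) : Set where
  field
    beyond : ∀ j → n ≤ j → cl j ≡ emptyBlock
    u₀-covered : exactlyOne (lu (cl 0) ∷ c0 ∷ []) ≡ true
    v₀-covered : exactlyOne (lv (cl 0) ∷ c0 ∷ []) ≡ true
    local : ∀ j → j < n → isLocalMatching (cl j) (lu (cl (suc j))) (lv (cl (suc j))) ≡ true

bitAt : Bool → (ℕ → Block) → Loc → Bool
bitAt c0 cl L0 = c0
bitAt c0 cl (LC j p) = bit (cl j) p

IsChain-cong : ∀ {n c0 c0' cl cl'} → c0 ≡ c0' → (∀ j → cl j ≡ cl' j) → IsChain n c0 cl → IsChain n c0' cl'
IsChain-cong {n} {c0} {c0'} {cl} {cl'} refl e ok = record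
  { beyond = λ j h → trans (sym (e j)) (IsChain.beyond ok j h)
  ; u₀-covered = subst (λ x → exactlyOne (lu x ∷ c0 ∷ []) ≡ true) (e 0) (IsChain.u₀-covered ok)
  ; v₀-covered = subst (λ x → exactlyOne (lv x ∷ c0 ∷ []) ≡ true) (e 0) (IsChain.v₀-covered ok)
  ; local = λ j h → subst₂ (λ x y → isLocalMatching x (lu y) (lv y) ≡ true) (e j) (e (suc j)) (IsChain.local ok j h)
  }

edgeKind : Edge → ℕ
edgeKind (eHu _) = 0
edgeKind (eHv _) = 1
edgeKind (eVt _) = 2
edgeKind (eWu _) = 3
edgeKind (eVz _) = 4
edgeKind (eWw _) = 5
edgeKind (eZz _) = 6

all-kind≡ : ∀ (C : ℕ → Edge) m t → (∀ k → edgeKind (C k) ≡ t) → All (λ e → edgeKind e ≡ t) (applyUpTo C m)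
all-kind≡ C m t h = AllP.applyUpTo⁺₂ C m h

all-kind> : ∀ (C : ℕ → Edge) m t → (∀ k → t < edgeKind (C k)) → All (λ e → t < edgeKind e) (applyUpTo C m)
all-kind> C m t h = AllP.applyUpTo⁺₂ C m h

kind-disjoint : ∀ {t} {xs ys : List Edge} → All (λ e → edgeKind e ≡ t) xs → All (λ e → t < edgeKind e) ys → Disjoint xs ys
kind-disjoint {t} a b (p , q) = <-irrefl refl (subst (t <_) (All.lookup a p) (All.lookup b q))

applyUpTo-unique : ∀ (C : ℕ → Edge) → (∀ {i j} → C i ≡ C j → i ≡ j) → ∀ m → Unique (applyUpTo C m)
applyUpTo-unique C inj m = UP.applyUpTo⁺₁ C m (λ i<j _ eq → <⇒≢ i<j (inj eq))

eHu-injective : ∀ {i j} → eHu i ≡ eHu j → i ≡ j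
eHu-injective refl = refl
eHv-injective : ∀ {i j} → eHv i ≡ eHv j → i ≡ j
eHv-injective refl = refl
eVt-injective : ∀ {i j} → eVt i ≡ eVt j → i ≡ j
eVt-injective refl = refl
eWu-injective : ∀ {i j} → eWu i ≡ eWu j → i ≡ j
eWu-injective refl = refl
eVz-injective : ∀ {i j} → eVz i ≡ eVz j → i ≡ j
eVz-injective refl = refl
eWw-injective : ∀ {i j} → eWw i ≡ eWw j → i ≡ j
eWw-injective refl = refl
eZz-injective : ∀ {i j} → eZz i ≡ eZz j → i ≡ j
eZz-injective refl = refl

edgeList-unique : ∀ n → Unique (edgeList n)
edgeList-unique n =
  UP.++⁺ (applyUpTo-unique eHu eHu-injective _) (UP.++⁺ (applyUpTo-unique eHv eHv-injective _) (UP.++⁺ (applyUpTo-unique eVt eVt-injective _) (UP.++⁺ (applyUpTo-unique eWu eWu-injective _)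
   (UP.++⁺ (applyUpTo-unique eVz eVz-injective _) (UP.++⁺ (applyUpTo-unique eWw eWw-injective _) (applyUpTo-unique eZz eZz-injective _)
     (kind-disjoint (all-kind≡ eWw n 5 λ _ → refl) (all-kind> eZz n 5 λ _ → ≤-refl)))
     (kind-disjoint (all-kind≡ eVz (2 * n) 4 λ _ → refl) (AllP.++⁺ (all-kind> eWw n 4 λ _ → ≤-refl) (all-kind> eZz n 4 λ _ → s≤s (s≤s (s≤s (s≤s (s≤s z≤n))))))))
     (kind-disjoint (all-kind≡ eWu (2 * n) 3 λ _ → refl) (AllP.++⁺ (all-kind> eVz (2 * n) 3 λ _ → ≤-refl)
        (AllP.++⁺ (all-kind> eWw n 3 λ _ → s≤s (s≤s (s≤s (s≤s z≤n)))) (all-kind> eZz n 3 λ _ → s≤s (s≤s (s≤s (s≤s z≤n))))))))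
     (kind-disjoint (all-kind≡ eVt (suc (2 * n)) 2 λ _ → refl) (AllP.++⁺ (all-kind> eWu (2 * n) 2 λ _ → ≤-refl)
        (AllP.++⁺ (all-kind> eVz (2 * n) 2 λ _ → s≤s (s≤s (s≤s z≤n)))
        (AllP.++⁺ (all-kind> eWw n 2 λ _ → s≤s (s≤s (s≤s z≤n))) (all-kind> eZz n 2 λ _ → s≤s (s≤s (s≤s z≤n))))))))
     (kind-disjoint (all-kind≡ eHv (2 * n) 1 λ _ → refl) (AllP.++⁺ (all-kind> eVt (suc (2 * n)) 1 λ _ → ≤-refl)
        (AllP.++⁺ (all-kind> eWu (2 * n) 1 λ _ → s≤s (s≤s z≤n))
        (AllP.++⁺ (all-kind> eVz (2 * n) 1 λ _ → s≤s (s≤s z≤n))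
        (AllP.++⁺ (all-kind> eWw n 1 λ _ → s≤s (s≤s z≤n)) (all-kind> eZz n 1 λ _ → s≤s (s≤s z≤n))))))))
     (kind-disjoint (all-kind≡ eHu (2 * n) 0 λ _ → refl) (AllP.++⁺ (all-kind> eHv (2 * n) 0 λ _ → ≤-refl)
        (AllP.++⁺ (all-kind> eVt (suc (2 * n)) 0 λ _ → s≤s z≤n)
        (AllP.++⁺ (all-kind> eWu (2 * n) 0 λ _ → s≤s z≤n)
        (AllP.++⁺ (all-kind> eVz (2 * n) 0 λ _ → s≤s z≤n)
        (AllP.++⁺ (all-kind> eWw n 0 λ _ → s≤s z≤n) (all-kind> eZz n 0 λ _ → s≤s z≤n)))))))

lookup-injective : ∀ {A : Set} {xs : List A} → Unique xs → ∀ i j → lookup xs i ≡ lookup xs j → i ≡ j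
lookup-injective {xs = x ∷ xs} (px ∷ un) Fin.zero Fin.zero _ = refl
lookup-injective {xs = x ∷ xs} (px ∷ un) Fin.zero (Fin.suc j) eq = ⊥-elim (All.lookup px (∈-lookup j) eq)
lookup-injective {xs = x ∷ xs} (px ∷ un) (Fin.suc i) Fin.zero eq = ⊥-elim (All.lookup px (∈-lookup i) (sym eq))
lookup-injective {xs = x ∷ xs} (px ∷ un) (Fin.suc i) (Fin.suc j) eq = cong Fin.suc (lookup-injective un i j eq)

edges-unique : ∀ n → Unique (edges (G n))
edges-unique n = subst Unique (sym (edges≡map-ends n)) (UP.map⁺ ends-injective (edgeList-unique n))

endpoints-injective : ∀ n (i j : EdgeIx (G n)) → endpoints (G n) i ≡ endpoints (G n) j → i ≡ j
endpoints-injective n i j eq = lookup-injective (edges-unique n) i j eq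

decoding : ∀ n (i : EdgeIx (G n)) → Σ Edge (λ e → e LM.∈ edgeList n × endpoints (G n) i ≡ ends e)
decoding n i = ∈-map⁻ ends (subst (λ l → lookup (edges (G n)) i LM.∈ l) (edges≡map-ends n) (∈-lookup i))

decode : ∀ n → EdgeIx (G n) → Edge
decode n i = proj₁ (decoding n i)

decode-inRange : ∀ n i → InRange n (decode n i)
decode-inRange n i = ∈edgeList⇒inRange n (decode n i) (proj₁ (proj₂ (decoding n i)))

decode-endpoints : ∀ n i → endpoints (G n) i ≡ ends (decode n i)
decode-endpoints n i = proj₂ (proj₂ (decoding n i))

∈edges : ∀ n e → InRange n e → ends e LM.∈ edges (G n)
∈edges n e h = subst (ends e LM.∈_) (sym (edges≡map-ends n)) (∈-map⁺ ends (inRange⇒∈edgeList n e h))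

encode : ∀ n e → InRange n e → EdgeIx (G n)
encode n e h = Any.index (∈edges n e h)

encode-endpoints : ∀ n e h → endpoints (G n) (encode n e h) ≡ ends e
encode-endpoints n e h = sym (lookup-index (∈edges n e h))

encode-unique : ∀ n e h i → endpoints (G n) i ≡ ends e → encode n e h ≡ i
encode-unique n e h i eq = endpoints-injective n _ _ (trans (encode-endpoints n e h) (sym eq))

decode-encode : ∀ n e h → decode n (encode n e h) ≡ e
decode-encode n e h = ends-injective (trans (sym (decode-endpoints n (encode n e h))) (encode-endpoints n e h))

encode-injective : ∀ n e e' h h' → encode n e h ≡ encode n e' h' → e ≡ e'
encode-injective n e e' h h' eq = ends-injective (trans (sym (encode-endpoints n e h)) (trans (cong (endpoints (G n)) eq) (encode-endpoints n e' h')))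

member : ∀ n → EdgeSet (G n) → Edge → Bool
member n M e with inRange? n e
... | yes h = Vec.lookup M (encode n e h)
... | no _ = false

member-inRange : ∀ n M e (h : InRange n e) → member n M e ≡ Vec.lookup M (encode n e h)
member-inRange n M e h with inRange? n e
... | yes h' = cong (Vec.lookup M) (encode-unique n e h' (encode n e h) (encode-endpoints n e h))
... | no ¬h = ⊥-elim (¬h h)

member-outOfRange : ∀ n M e → ¬ InRange n e → member n M e ≡ false
member-outOfRange n M e ¬h with inRange? n e
... | yes h = ⊥-elim (¬h h)
... | no _ = refl

member-true : ∀ n M e → member n M e ≡ true → Σ (InRange n e) λ h → Vec.lookup M (encode n e h) ≡ true
member-true n M e eq with inRange? n e
... | yes h = h , eq
... | no _ with eq
... | ()

member-decode : ∀ n M i → member n M (decode n i) ≡ Vec.lookup M i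
member-decode n M i = trans (member-inRange n M (decode n i) (decode-inRange n i))
  (cong (Vec.lookup M) (encode-unique n (decode n i) (decode-inRange n i) i (decode-endpoints n i)))

Touches : Vtx → Vtx × Vtx → Set
Touches x (a , b) = (x ≡ a) ⊎ (x ≡ b)

Incident⇒Touches : ∀ (H : Graph Vtx) x i → Incident H x i → Touches x (endpoints H i)
Incident⇒Touches H x i p with endpoints H i
... | (a , b) = p

Touches⇒Incident : ∀ (H : Graph Vtx) x i → Touches x (endpoints H i) → Incident H x i
Touches⇒Incident H x i p with endpoints H i
... | (a , b) = p

incidentEdges : Vtx → List Edge
incidentEdges (u zero) = eHu 0 ∷ eVt 0 ∷ []
incidentEdges (u (suc m)) = eHu m ∷ eHu (suc m) ∷ eVt (suc m) ∷ eWu m ∷ []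
incidentEdges (v zero) = eHv 0 ∷ eVt 0 ∷ []
incidentEdges (v (suc m)) = eHv m ∷ eHv (suc m) ∷ eVt (suc m) ∷ eVz m ∷ []
incidentEdges (w zero) = []
incidentEdges (w (suc m)) = eWu m ∷ eWw ⌊ m /2⌋ ∷ []
incidentEdges (z zero) = []
incidentEdges (z (suc m)) = eVz m ∷ eZz ⌊ m /2⌋ ∷ []

⌊suc-2*/2⌋≡ : ∀ k → ⌊ suc (2 * k) /2⌋ ≡ k
⌊suc-2*/2⌋≡ k rewrite 2*≡dbl k = ⌊suc-dbl/2⌋≡ k

incidentEdges-complete : ∀ x e → Touches x (ends e) → e LM.∈ incidentEdges x
incidentEdges-complete .(u zero) (eHu zero) (inj₁ refl) = here refl
incidentEdges-complete .(u (suc m)) (eHu (suc m)) (inj₁ refl) = there (here refl)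
incidentEdges-complete .(u (suc k)) (eHu k) (inj₂ refl) = here refl
incidentEdges-complete .(v zero) (eHv zero) (inj₁ refl) = here refl
incidentEdges-complete .(v (suc m)) (eHv (suc m)) (inj₁ refl) = there (here refl)
incidentEdges-complete .(v (suc k)) (eHv k) (inj₂ refl) = here refl
incidentEdges-complete .(u zero) (eVt zero) (inj₁ refl) = there (here refl)
incidentEdges-complete .(u (suc m)) (eVt (suc m)) (inj₁ refl) = there (there (here refl))
incidentEdges-complete .(v zero) (eVt zero) (inj₂ refl) = there (here refl)
incidentEdges-complete .(v (suc m)) (eVt (suc m)) (inj₂ refl) = there (there (here refl))
incidentEdges-complete .(w (suc k)) (eWu k) (inj₁ refl) = here refl
incidentEdges-complete .(u (suc k)) (eWu k) (inj₂ refl) = there (there (there (here refl)))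
incidentEdges-complete .(v (suc k)) (eVz k) (inj₁ refl) = there (there (there (here refl)))
incidentEdges-complete .(z (suc k)) (eVz k) (inj₂ refl) = here refl
incidentEdges-complete .(w (suc (2 * k))) (eWw k) (inj₁ refl) = there (here (cong eWw (sym (⌊2*/2⌋≡ k))))
incidentEdges-complete .(w (suc (suc (2 * k)))) (eWw k) (inj₂ refl) = there (here (cong eWw (sym (⌊suc-2*/2⌋≡ k))))
incidentEdges-complete .(z (suc (2 * k))) (eZz k) (inj₁ refl) = there (here (cong eZz (sym (⌊2*/2⌋≡ k))))
incidentEdges-complete .(z (suc (suc (2 * k)))) (eZz k) (inj₂ refl) = there (here (cong eZz (sym (⌊suc-2*/2⌋≡ k))))

touches-eWw : ∀ m → Touches (w (suc m)) (ends (eWw ⌊ m /2⌋))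
touches-eWw m with parity m
... | evenᵖ j rewrite ⌊dbl/2⌋≡ j | 2*≡dbl j = inj₁ refl
... | oddᵖ j rewrite ⌊suc-dbl/2⌋≡ j | 2*≡dbl j = inj₂ refl

touches-eZz : ∀ m → Touches (z (suc m)) (ends (eZz ⌊ m /2⌋))
touches-eZz m with parity m
... | evenᵖ j rewrite ⌊dbl/2⌋≡ j | 2*≡dbl j = inj₁ refl
... | oddᵖ j rewrite ⌊suc-dbl/2⌋≡ j | 2*≡dbl j = inj₂ refl

incidentEdges-sound : ∀ x e → e LM.∈ incidentEdges x → Touches x (ends e)
incidentEdges-sound (u zero) .(eHu 0) (here refl) = inj₁ refl
incidentEdges-sound (u zero) .(eVt 0) (there (here refl)) = inj₁ refl
incidentEdges-sound (u (suc m)) .(eHu m) (here refl) = inj₂ refl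
incidentEdges-sound (u (suc m)) .(eHu (suc m)) (there (here refl)) = inj₁ refl
incidentEdges-sound (u (suc m)) .(eVt (suc m)) (there (there (here refl))) = inj₁ refl
incidentEdges-sound (u (suc m)) .(eWu m) (there (there (there (here refl)))) = inj₂ refl
incidentEdges-sound (v zero) .(eHv 0) (here refl) = inj₁ refl
incidentEdges-sound (v zero) .(eVt 0) (there (here refl)) = inj₂ refl
incidentEdges-sound (v (suc m)) .(eHv m) (here refl) = inj₂ refl
incidentEdges-sound (v (suc m)) .(eHv (suc m)) (there (here refl)) = inj₁ refl
incidentEdges-sound (v (suc m)) .(eVt (suc m)) (there (there (here refl))) = inj₂ refl
incidentEdges-sound (v (suc m)) .(eVz m) (there (there (there (here refl)))) = inj₁ refl
incidentEdges-sound (w (suc m)) .(eWu m) (here refl) = inj₁ refl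
incidentEdges-sound (w (suc m)) .(eWw ⌊ m /2⌋) (there (here refl)) = touches-eWw m
incidentEdges-sound (z (suc m)) .(eVz m) (here refl) = inj₂ refl
incidentEdges-sound (z (suc m)) .(eZz ⌊ m /2⌋) (there (here refl)) = touches-eZz m

hu≢ : ∀ m → eHu m ≢ eHu (suc m)
hu≢ m eq = <⇒≢ (n<1+n m) (eHu-injective eq)
hv≢ : ∀ m → eHv m ≢ eHv (suc m)
hv≢ m eq = <⇒≢ (n<1+n m) (eHv-injective eq)

incidentEdges-unique : ∀ x → Unique (incidentEdges x)
incidentEdges-unique (u zero) = ((λ ()) ∷ []) ∷ [] ∷ []
incidentEdges-unique (u (suc m)) = (hu≢ m ∷ (λ ()) ∷ (λ ()) ∷ []) ∷ ((λ ()) ∷ (λ ()) ∷ []) ∷ ((λ ()) ∷ []) ∷ [] ∷ []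
incidentEdges-unique (v zero) = ((λ ()) ∷ []) ∷ [] ∷ []
incidentEdges-unique (v (suc m)) = (hv≢ m ∷ (λ ()) ∷ (λ ()) ∷ []) ∷ ((λ ()) ∷ (λ ()) ∷ []) ∷ ((λ ()) ∷ []) ∷ [] ∷ []
incidentEdges-unique (w zero) = []
incidentEdges-unique (w (suc m)) = ((λ ()) ∷ []) ∷ [] ∷ []
incidentEdges-unique (z zero) = []
incidentEdges-unique (z (suc m)) = ((λ ()) ∷ []) ∷ [] ∷ []

-- Perfect matchings as chains of blocks

none-map-elim : ∀ (f : Edge → Bool) xs → none (map f xs) ≡ true → ∀ e → e LM.∈ xs → f e ≡ false
none-map-elim f (x ∷ xs) h e (here refl) with f x
... | false = refl
none-map-elim f (x ∷ xs) h e (there p) with f x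
... | false = none-map-elim f xs h e p

none-map-intro : ∀ (f : Edge → Bool) xs → (∀ e → e LM.∈ xs → f e ≡ false) → none (map f xs) ≡ true
none-map-intro f [] h = refl
none-map-intro f (x ∷ xs) h with f x in eq
... | false = none-map-intro f xs (λ e p → h e (there p))
... | true with trans (sym eq) (h x (here refl))
... | ()

ExactlyOne : (Edge → Bool) → List Edge → Set
ExactlyOne f xs = (Σ Edge λ e → e LM.∈ xs × f e ≡ true) ×
             (∀ e e' → e LM.∈ xs → e' LM.∈ xs → f e ≡ true → f e' ≡ true → e ≡ e')

exactlyOne-elim : ∀ (f : Edge → Bool) xs → exactlyOne (map f xs) ≡ true → ExactlyOne f xs
exactlyOne-elim f [] ()
exactlyOne-elim f (x ∷ xs) h with f x in eq
... | true = (x , here refl , eq) , unique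
  where
  unique : ∀ e e' → e LM.∈ x ∷ xs → e' LM.∈ x ∷ xs → f e ≡ true → f e' ≡ true → e ≡ e'
  unique e e' (here refl) (here refl) _ _ = refl
  unique e e' (here refl) (there q) _ t' with trans (sym t') (none-map-elim f xs h e' q)
  ... | ()
  unique e e' (there p) _ t _ with trans (sym t) (none-map-elim f xs h e p)
  ... | ()
... | false with exactlyOne-elim f xs h
... | (e , p , t) , uq0 = (e , there p , t) , unique
  where
  unique : ∀ e e' → e LM.∈ x ∷ xs → e' LM.∈ x ∷ xs → f e ≡ true → f e' ≡ true → e ≡ e'
  unique e e' (here refl) _ t _ with trans (sym t) eq
  ... | ()
  unique e e' (there p) (here refl) _ t' with trans (sym t') eq
  ... | ()
  unique e e' (there p) (there q) t t' = uq0 e e' p q t t'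

exactlyOne-intro : ∀ (f : Edge → Bool) xs → Unique xs → ExactlyOne f xs → exactlyOne (map f xs) ≡ true
exactlyOne-intro f [] _ ((e , () , _) , _)
exactlyOne-intro f (x ∷ xs) (px ∷ un) ((e , p , t) , unique) with f x in eq
... | true = none-map-intro f xs rest-false
  where
  rest-false : ∀ e → e LM.∈ xs → f e ≡ false
  rest-false e q with f e in eq'
  ... | false = refl
  ... | true = ⊥-elim (All.lookup px q (unique x e (here refl) (there q) eq eq'))
... | false = exactlyOne-intro f xs un ((e , in-tail p , t) , λ e e' q q' → unique e e' (there q) (there q'))
  where
  in-tail : e LM.∈ x ∷ xs → e LM.∈ xs
  in-tail (here refl) with trans (sym t) eq
  ... | ()
  in-tail (there q) = q

IsVertex : ℕ → Vtx → Set
IsVertex n (u i) = i ≤ dbl n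
IsVertex n (v i) = i ≤ dbl n
IsVertex n (w zero) = ⊥
IsVertex n (w (suc m)) = m < dbl n
IsVertex n (z zero) = ⊥
IsVertex n (z (suc m)) = m < dbl n

columnVertices : ℕ → List Vtx
columnVertices k = u (suc k) ∷ v (suc k) ∷ w (suc k) ∷ z (suc k) ∷ []

∈vertices⇒IsVertex : ∀ n x → x LM.∈ vertices (G n) → IsVertex n x
∈vertices⇒IsVertex n .(u 0) (here refl) = z≤n
∈vertices⇒IsVertex n .(v 0) (there (here refl)) = z≤n
∈vertices⇒IsVertex n x (there (there p)) with LM.find (∈-concatMap⁻ columnVertices {xs = applyUpTo (λ k → k) (2 * n)} p)
... | k , kin , q with ∈-applyUpTo⁻ (λ k → k) kin
... | .k , k< , refl with q
... | here refl = subst (suc k ≤_) (2*≡dbl n) k<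
... | there (here refl) = subst (suc k ≤_) (2*≡dbl n) k<
... | there (there (here refl)) = subst (k <_) (2*≡dbl n) k<
... | there (there (there (here refl))) = subst (k <_) (2*≡dbl n) k<

IsVertex⇒∈vertices : ∀ n x → IsVertex n x → x LM.∈ vertices (G n)
IsVertex⇒∈vertices n (u zero) h = here refl
IsVertex⇒∈vertices n (v zero) h = there (here refl)
IsVertex⇒∈vertices n (u (suc k)) h = there (there (∈-concatMap⁺ columnVertices (LM.lose (∈-applyUpTo⁺ (λ k → k) (subst (k <_) (sym (2*≡dbl n)) h)) (here refl))))
IsVertex⇒∈vertices n (v (suc k)) h = there (there (∈-concatMap⁺ columnVertices (LM.lose (∈-applyUpTo⁺ (λ k → k) (subst (k <_) (sym (2*≡dbl n)) h)) (there (here refl)))))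
IsVertex⇒∈vertices n (w (suc k)) h = there (there (∈-concatMap⁺ columnVertices (LM.lose (∈-applyUpTo⁺ (λ k → k) (subst (k <_) (sym (2*≡dbl n)) h)) (there (there (here refl))))))
IsVertex⇒∈vertices n (z (suc k)) h = there (there (∈-concatMap⁺ columnVertices (LM.lose (∈-applyUpTo⁺ (λ k → k) (subst (k <_) (sym (2*≡dbl n)) h)) (there (there (there (here refl)))))))

module _ (n : ℕ) (M : EdgeSet (G n)) where

  private
    inM : Edge → Bool
    inM = member n M

  perfect⇒exactlyOne : IsPerfectMatching (G n) M → ∀ x → x LM.∈ vertices (G n) → exactlyOne (map inM (incidentEdges x)) ≡ true
  perfect⇒exactlyOne pm x xin = exactlyOne-intro inM (incidentEdges x) (incidentEdges-unique x) (existence , unique)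
    where
    existence : Σ Edge λ e → e LM.∈ incidentEdges x × inM e ≡ true
    existence with proj₁ (pm x xin)
    ... | i , iM , inc = decode n i ,
          incidentEdges-complete x (decode n i) (subst (Touches x) (decode-endpoints n i) (Incident⇒Touches (G n) x i inc)) ,
          trans (member-decode n M i) ([]=⇒lookup iM)
    unique : ∀ e e' → e LM.∈ incidentEdges x → e' LM.∈ incidentEdges x → inM e ≡ true → inM e' ≡ true → e ≡ e'
    unique e e' p in-tail t t' with member-true n M e t | member-true n M e' t'
    ... | h , l | h' , l' =
      encode-injective n e e' h h' (proj₂ (pm x xin) (encode n e h) (encode n e' h')
        (lookup⇒[]= (encode n e h) M l) (lookup⇒[]= (encode n e' h') M l')
        (Touches⇒Incident (G n) x _ (subst (Touches x) (sym (encode-endpoints n e h)) (incidentEdges-sound x e p)))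
        (Touches⇒Incident (G n) x _ (subst (Touches x) (sym (encode-endpoints n e' h')) (incidentEdges-sound x e' in-tail))))

  exactlyOne⇒perfect : (∀ x → x LM.∈ vertices (G n) → exactlyOne (map inM (incidentEdges x)) ≡ true) → IsPerfectMatching (G n) M
  exactlyOne⇒perfect h x xin = existence , unique
    where
    E1 = exactlyOne-elim inM (incidentEdges x) (h x xin)
    existence : ∃ λ i → (i FS.∈ M) × Incident (G n) x i
    existence with proj₁ E1
    ... | e , p , t with member-true n M e t
    ... | hv , l = encode n e hv , lookup⇒[]= (encode n e hv) M l ,
                   Touches⇒Incident (G n) x _ (subst (Touches x) (sym (encode-endpoints n e hv)) (incidentEdges-sound x e p))
    unique : ∀ i i' → i FS.∈ M → i' FS.∈ M → Incident (G n) x i → Incident (G n) x i' → i ≡ i'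
    unique i i' iM i'M inc inc' = endpoints-injective n i i' (trans (decode-endpoints n i) (trans (cong ends eq) (sym (decode-endpoints n i'))))
      where
      eq : decode n i ≡ decode n i'
      eq = proj₂ E1 (decode n i) (decode n i')
             (incidentEdges-complete x (decode n i) (subst (Touches x) (decode-endpoints n i) (Incident⇒Touches (G n) x i inc)))
             (incidentEdges-complete x (decode n i') (subst (Touches x) (decode-endpoints n i') (Incident⇒Touches (G n) x i' inc')))
             (trans (member-decode n M i) ([]=⇒lookup iM)) (trans (member-decode n M i') ([]=⇒lookup i'M))

  blockAt : ℕ → Block
  blockAt j = block (inM (eHu (suc (dbl j)))) (inM (eHv (suc (dbl j)))) (inM (eVt (suc (dbl j)))) (inM (eVt (suc (suc (dbl j)))))
                  (inM (eWu (dbl j))) (inM (eWu (suc (dbl j)))) (inM (eWw j)) (inM (eVz (dbl j))) (inM (eVz (suc (dbl j)))) (inM (eZz j))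
                  (inM (eHu (dbl j))) (inM (eHv (dbl j)))

  rung₀ : Bool
  rung₀ = inM (eVt 0)

  bitAt-blockAt : ∀ l → bitAt rung₀ blockAt l ≡ inM (edgeAt l)
  bitAt-blockAt L0 = refl
  bitAt-blockAt (LC j pHu) = refl
  bitAt-blockAt (LC j pHv) = refl
  bitAt-blockAt (LC j pVa) = refl
  bitAt-blockAt (LC j pVb) = refl
  bitAt-blockAt (LC j pWa) = refl
  bitAt-blockAt (LC j pWb) = refl
  bitAt-blockAt (LC j pWW) = refl
  bitAt-blockAt (LC j pZa) = refl
  bitAt-blockAt (LC j pZb) = refl
  bitAt-blockAt (LC j pZZ) = refl
  bitAt-blockAt (LC j pLu) = refl
  bitAt-blockAt (LC j pLv) = refl

  bitAt-locOf : ∀ e → bitAt rung₀ blockAt (locOf e) ≡ inM e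
  bitAt-locOf e = trans (bitAt-blockAt (locOf e)) (cong inM (edgeAt-locOf e))

  outOfRange : ∀ j p → n ≤ j → ¬ InRange n (edgeAt (LC j p))
  outOfRange j p nj h = <⇒≱ (subst (LocInRange n) (locOf-edgeAt (LC j p)) (inRange⇒locInRange n _ h)) nj

  blockAt-beyond : ∀ j → n ≤ j → blockAt j ≡ emptyBlock
  blockAt-beyond j nj = block-ext λ p → trans (bitAt-blockAt (LC j p)) (trans (member-outOfRange n M _ (outOfRange j p nj)) (sym (bit-emptyBlock p)))

  exactlyOne⇒IsChain : (∀ x → IsVertex n x → exactlyOne (map inM (incidentEdges x)) ≡ true) → IsChain n rung₀ blockAt
  exactlyOne⇒IsChain h = record { beyond = blockAt-beyond ; u₀-covered = h (u 0) z≤n ; v₀-covered = h (v 0) z≤n ; local = lc }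
    where
    lc : ∀ j → j < n → isLocalMatching (blockAt j) (lu (blockAt (suc j))) (lv (blockAt (suc j))) ≡ true
    lc j jn = isLocalMatching-intro (blockAt j) (lu (blockAt (suc j))) (lv (blockAt (suc j))) (h (u (suc (dbl j))) (dbl-mono-< jn)) (h (v (suc (dbl j))) (dbl-mono-< jn))
             (h (u (suc (suc (dbl j)))) (suc-dbl<dbl jn)) (h (v (suc (suc (dbl j)))) (suc-dbl<dbl jn))
             (subst (λ t → exactlyOne (inM (eWu (dbl j)) ∷ inM (eWw t) ∷ []) ≡ true) (⌊dbl/2⌋≡ j) (h (w (suc (dbl j))) (dbl-mono-< jn)))
             (subst (λ t → exactlyOne (inM (eWu (suc (dbl j))) ∷ inM (eWw t) ∷ []) ≡ true) (⌊suc-dbl/2⌋≡ j) (h (w (suc (suc (dbl j)))) (suc-dbl<dbl jn)))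
             (subst (λ t → exactlyOne (inM (eVz (dbl j)) ∷ inM (eZz t) ∷ []) ≡ true) (⌊dbl/2⌋≡ j) (h (z (suc (dbl j))) (dbl-mono-< jn)))
             (subst (λ t → exactlyOne (inM (eVz (suc (dbl j))) ∷ inM (eZz t) ∷ []) ≡ true) (⌊suc-dbl/2⌋≡ j) (h (z (suc (suc (dbl j)))) (suc-dbl<dbl jn)))

  IsChain⇒exactlyOne : IsChain n rung₀ blockAt → ∀ x → IsVertex n x → exactlyOne (map inM (incidentEdges x)) ≡ true
  IsChain⇒exactlyOne ok (u zero) _ = IsChain.u₀-covered ok
  IsChain⇒exactlyOne ok (v zero) _ = IsChain.v₀-covered ok
  IsChain⇒exactlyOne ok (u (suc k)) hk with parity k
  ... | evenᵖ j = covers-ua (blockAt j) (lu (blockAt (suc j))) (lv (blockAt (suc j))) (IsChain.local ok j (dbl-cancel-< hk))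
  ... | oddᵖ j = covers-ub (blockAt j) (lu (blockAt (suc j))) (lv (blockAt (suc j))) (IsChain.local ok j (suc-dbl-cancel-< hk))
  IsChain⇒exactlyOne ok (v (suc k)) hk with parity k
  ... | evenᵖ j = covers-va (blockAt j) (lu (blockAt (suc j))) (lv (blockAt (suc j))) (IsChain.local ok j (dbl-cancel-< hk))
  ... | oddᵖ j = covers-vb (blockAt j) (lu (blockAt (suc j))) (lv (blockAt (suc j))) (IsChain.local ok j (suc-dbl-cancel-< hk))
  IsChain⇒exactlyOne ok (w (suc k)) hk with parity k
  ... | evenᵖ j rewrite ⌊dbl/2⌋≡ j = covers-wa (blockAt j) (lu (blockAt (suc j))) (lv (blockAt (suc j))) (IsChain.local ok j (dbl-cancel-< hk))
  ... | oddᵖ j rewrite ⌊suc-dbl/2⌋≡ j = covers-wb (blockAt j) (lu (blockAt (suc j))) (lv (blockAt (suc j))) (IsChain.local ok j (suc-dbl-cancel-< hk))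
  IsChain⇒exactlyOne ok (z (suc k)) hk with parity k
  ... | evenᵖ j rewrite ⌊dbl/2⌋≡ j = covers-za (blockAt j) (lu (blockAt (suc j))) (lv (blockAt (suc j))) (IsChain.local ok j (dbl-cancel-< hk))
  ... | oddᵖ j rewrite ⌊suc-dbl/2⌋≡ j = covers-zb (blockAt j) (lu (blockAt (suc j))) (lv (blockAt (suc j))) (IsChain.local ok j (suc-dbl-cancel-< hk))

  perfect⇒IsChain : IsPerfectMatching (G n) M → IsChain n rung₀ blockAt
  perfect⇒IsChain pm = exactlyOne⇒IsChain (λ x h → perfect⇒exactlyOne pm x (IsVertex⇒∈vertices n x h))

  IsChain⇒perfect : IsChain n rung₀ blockAt → IsPerfectMatching (G n) M
  IsChain⇒perfect ok = exactlyOne⇒perfect (λ x xin → IsChain⇒exactlyOne ok x (∈vertices⇒IsVertex n x xin))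

edgeSet-ext : ∀ n (M M' : EdgeSet (G n)) → (∀ e → member n M e ≡ member n M' e) → M ≡ M'
edgeSet-ext n M M' h = trans (sym (tabulate∘lookup M)) (trans (tabulate-cong
  (λ i → trans (sym (member-decode n M i)) (trans (h (decode n i)) (member-decode n M' i)))) (tabulate∘lookup M'))

bitAt-cong : ∀ {c0 c0' cl cl'} → c0 ≡ c0' → (∀ j → cl j ≡ cl' j) → ∀ l → bitAt c0 cl l ≡ bitAt c0' cl' l
bitAt-cong e0 ec L0 = e0
bitAt-cong e0 ec (LC j p) = cong (λ x → bit x p) (ec j)

chain-ext : ∀ n (M M' : EdgeSet (G n)) → rung₀ n M ≡ rung₀ n M' → (∀ j → blockAt n M j ≡ blockAt n M' j) → M ≡ M'
chain-ext n M M' e0 ec = edgeSet-ext n M M' λ e → trans (sym (bitAt-locOf n M e))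
  (trans (bitAt-cong e0 ec (locOf e)) (bitAt-locOf n M' e))

toEdgeSet : ∀ n → Bool → (ℕ → Block) → EdgeSet (G n)
toEdgeSet n c0 cl = Vec.tabulate (λ i → bitAt c0 cl (locOf (decode n i)))

module _ (n : ℕ) (c0 : Bool) (cl : ℕ → Block) where

  private
    F : EdgeSet (G n)
    F = toEdgeSet n c0 cl

  member-toEdgeSet : ∀ e → InRange n e → member n F e ≡ bitAt c0 cl (locOf e)
  member-toEdgeSet e h = trans (member-inRange n F e h) (trans (lookup∘tabulate _ (encode n e h))
                  (cong (λ t → bitAt c0 cl (locOf t)) (decode-encode n e h)))

  bit-blockAt-toEdgeSet : ∀ j p → j < n → bit (blockAt n F j) p ≡ bit (cl j) p
  bit-blockAt-toEdgeSet j p jn = trans (bitAt-blockAt n F (LC j p)) (trans (member-toEdgeSet (edgeAt (LC j p)) (locInRange⇒inRange n (LC j p) jn))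
                 (cong (bitAt c0 cl) (locOf-edgeAt (LC j p))))

  blockAt-toEdgeSet : IsChain n c0 cl → ∀ j → blockAt n F j ≡ cl j
  blockAt-toEdgeSet ok j with n ≤? j
  ... | no nj = block-ext λ p → bit-blockAt-toEdgeSet j p (≰⇒> nj)
  ... | yes nj = trans (blockAt-beyond n F j nj) (sym (IsChain.beyond ok j nj))

  rung₀-toEdgeSet : rung₀ n F ≡ c0
  rung₀-toEdgeSet = member-toEdgeSet (eVt 0) (s≤s z≤n)

  toEdgeSet-perfect : IsChain n c0 cl → IsPerfectMatching (G n) F
  toEdgeSet-perfect ok = IsChain⇒perfect n F (IsChain-cong (sym rung₀-toEdgeSet) (λ j → sym (blockAt-toEdgeSet ok j)) ok)

predecessors : ∀ {m} → List (Fin (suc m)) → List (Fin m)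
predecessors [] = []
predecessors (Fin.zero ∷ xs) = predecessors xs
predecessors (Fin.suc i ∷ xs) = i ∷ predecessors xs

count-zero : ∀ {m} → List (Fin (suc m)) → ℕ
count-zero [] = 0
count-zero (Fin.zero ∷ xs) = suc (count-zero xs)
count-zero (Fin.suc _ ∷ xs) = count-zero xs

length-split : ∀ {m} (xs : List (Fin (suc m))) → length xs ≡ count-zero xs + length (predecessors xs)
length-split [] = refl
length-split (Fin.zero ∷ xs) = cong suc (length-split xs)
length-split (Fin.suc _ ∷ xs) = trans (cong suc (length-split xs)) (sym (+-suc (count-zero xs) _))

∈-predecessors⁻ : ∀ {m} {i : Fin m} xs → i LM.∈ predecessors xs → Fin.suc i LM.∈ xs
∈-predecessors⁻ (Fin.zero ∷ xs) p = there (∈-predecessors⁻ xs p)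
∈-predecessors⁻ (Fin.suc _ ∷ xs) (here refl) = here refl
∈-predecessors⁻ (Fin.suc _ ∷ xs) (there p) = there (∈-predecessors⁻ xs p)

∈-predecessors⁺ : ∀ {m} {i : Fin m} xs → Fin.suc i LM.∈ xs → i LM.∈ predecessors xs
∈-predecessors⁺ (Fin.zero ∷ xs) (there p) = ∈-predecessors⁺ xs p
∈-predecessors⁺ (Fin.suc _ ∷ xs) (here refl) = here refl
∈-predecessors⁺ (Fin.suc _ ∷ xs) (there p) = there (∈-predecessors⁺ xs p)

predecessors-unique : ∀ {m} (xs : List (Fin (suc m))) → Unique xs → Unique (predecessors xs)
predecessors-unique [] _ = []
predecessors-unique (Fin.zero ∷ xs) (_ ∷ un) = predecessors-unique xs un
predecessors-unique (Fin.suc _ ∷ xs) (px ∷ un) =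
  All.tabulate (λ q eq → All.lookup px (∈-predecessors⁻ xs q) (cong Fin.suc eq)) ∷ predecessors-unique xs un

count-zero≡0 : ∀ {m} (xs : List (Fin (suc m))) → ¬ Fin.zero LM.∈ xs → count-zero xs ≡ 0
count-zero≡0 [] _ = refl
count-zero≡0 (Fin.zero ∷ xs) h = ⊥-elim (h (here refl))
count-zero≡0 (Fin.suc _ ∷ xs) h = count-zero≡0 xs (λ p → h (there p))

count-zero≤b2n : ∀ {m} b (xs : List (Fin (suc m))) → Unique xs → (Fin.zero LM.∈ xs → b ≡ true) → count-zero xs ≤ b2n b
count-zero≤b2n true [] _ _ = z≤n
count-zero≤b2n true (Fin.zero ∷ xs) (px ∷ _) _ = s≤s (≤-reflexive (count-zero≡0 xs (λ p → All.lookup px p refl)))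
count-zero≤b2n true (Fin.suc _ ∷ xs) (_ ∷ un) h = count-zero≤b2n true xs un (λ _ → refl)
count-zero≤b2n false xs _ h = ≤-reflexive (count-zero≡0 xs (λ p → false≢true (h p)))
  where
  false≢true : false ≢ true
  false≢true ()

b2n≤count-zero : ∀ {m} b (xs : List (Fin (suc m))) → (b ≡ true → Fin.zero LM.∈ xs) → b2n b ≤ count-zero xs
b2n≤count-zero false xs _ = z≤n
b2n≤count-zero true xs h = zero∈⇒1≤ xs (h refl)
  where
  zero∈⇒1≤ : ∀ xs → Fin.zero LM.∈ xs → 1 ≤ count-zero xs
  zero∈⇒1≤ (Fin.zero ∷ _) _ = s≤s z≤n
  zero∈⇒1≤ (Fin.suc _ ∷ xs) (there p) = zero∈⇒1≤ xs p

∣b∷S∣ : ∀ {m} b (S : Subset m) → ∣ b ∷ S ∣ ≡ b2n b + ∣ S ∣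
∣b∷S∣ true S = refl
∣b∷S∣ false S = refl

length≤∣_∣ : ∀ {m} (S : Subset m) {xs : List (Fin m)} → Unique xs → (∀ i → i LM.∈ xs → Vec.lookup S i ≡ true) → length xs ≤ ∣ S ∣
length≤∣ [] ∣ {[]} _ _ = z≤n
length≤∣ [] ∣ {() ∷ _} _ _
length≤∣ b ∷ S ∣ {xs} un h rewrite length-split xs | ∣b∷S∣ b S =
  +-mono-≤ (count-zero≤b2n b xs un (h Fin.zero))
           (length≤∣ S ∣ (predecessors-unique xs un) (λ i p → h (Fin.suc i) (∈-predecessors⁻ xs p)))

∣_∣≤length : ∀ {m} (S : Subset m) {xs : List (Fin m)} → (∀ i → Vec.lookup S i ≡ true → i LM.∈ xs) → ∣ S ∣ ≤ length xs
∣ [] ∣≤length _ = z≤n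
∣ b ∷ S ∣≤length {xs} h rewrite length-split xs | ∣b∷S∣ b S =
  +-mono-≤ (b2n≤count-zero b xs (h Fin.zero)) (∣ S ∣≤length (λ i t → ∈-predecessors⁺ xs (h (Fin.suc i) t)))

module _ {m : ℕ} {L : Set} (S : Subset m) (label : Fin m → L) where

  private
    Hit : L → Set
    Hit t = Σ[ i ∈ Fin m ] (Vec.lookup S i ≡ true × label i ≡ t)

    hits : (ts : List L) → (∀ t → t LM.∈ ts → Hit t) → List (Fin m)
    hits [] f = []
    hits (t ∷ ts) f = proj₁ (f t (here refl)) ∷ hits ts (λ t' p → f t' (there p))

    map-label-hits : ∀ ts f → map label (hits ts f) ≡ ts
    map-label-hits [] f = refl
    map-label-hits (t ∷ ts) f = cong₂ _∷_ (proj₂ (proj₂ (f t (here refl)))) (map-label-hits ts (λ t' p → f t' (there p)))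

    length-hits : ∀ ts f → length (hits ts f) ≡ length ts
    length-hits [] f = refl
    length-hits (t ∷ ts) f = cong suc (length-hits ts (λ t' p → f t' (there p)))

    hits⊆S : ∀ ts f i → i LM.∈ hits ts f → Vec.lookup S i ≡ true
    hits⊆S (t ∷ ts) f i (here refl) = proj₁ (proj₂ (f t (here refl)))
    hits⊆S (t ∷ ts) f i (there p) = hits⊆S ts (λ t' p → f t' (there p)) i p

  length≤∣S∣-by-labels : (ts : List L) → Unique ts → (∀ t → t LM.∈ ts → Hit t) → length ts ≤ ∣ S ∣
  length≤∣S∣-by-labels ts uts f = subst (_≤ ∣ S ∣) (length-hits ts f)
    (length≤∣ S ∣ (UP.map⁻ (subst Unique (sym (map-label-hits ts f)) uts)) (hits⊆S ts f))

-- Anti-forcing sets meet every other perfect matching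

record Alternative {V : Set} (H : Graph V) (M : EdgeSet H) {L : Set} (label : EdgeIx H → L) (t : L) : Set where
  field
    matching : EdgeSet H
    perfect : IsPerfectMatching H matching
    ≢M : matching ≢ M
    labelled : ∀ i → Vec.lookup matching i ≡ true → Vec.lookup M i ≡ false → label i ≡ t

module _ {V : Set} (H : Graph V) {M S : EdgeSet H} (af : IsAntiForcingSet H M S)
         {L : Set} (label : EdgeIx H → L) where

  anti-forcing-hits : ∀ {t} → Alternative H M label t → Σ[ i ∈ EdgeIx H ] (Vec.lookup S i ≡ true × label i ≡ t)
  anti-forcing-hits A
    with FP.any? (λ i → (Vec.lookup S i B.≟ true) ×-dec (Vec.lookup (Alternative.matching A) i B.≟ true))
  ... | yes (i , i∈S , i∈A) = i , i∈S ,
        Alternative.labelled A i i∈A (¬true⇒false λ i∈M → proj₁ af i (lookup⇒[]= i S i∈S) (lookup⇒[]= i M i∈M))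
  ... | no S∩A≡∅ = ⊥-elim (Alternative.≢M A (proj₂ af _ (Alternative.perfect A)
        (λ i i∈S i∈A → S∩A≡∅ (i , []=⇒lookup i∈S , []=⇒lookup i∈A))))

  anti-forcing-lower-bound : (ts : List L) → Unique ts → (∀ t → t LM.∈ ts → Alternative H M label t) →
    length ts ≤ ∣ S ∣
  anti-forcing-lower-bound ts uts alt = length≤∣S∣-by-labels S label ts uts (λ t p → anti-forcing-hits (alt t p))

consIf : ∀ {A : Set} → Bool → A → List A → List A
consIf true y ys = y ∷ ys
consIf false y ys = ys

length-consIf : ∀ {A : Set} b (y : A) ys → length (consIf b y ys) ≡ b2n b + length ys
length-consIf true y ys = refl
length-consIf false y ys = refl

consIf-here : ∀ {A : Set} b (y : A) ys → b ≡ true → y LM.∈ consIf b y ys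
consIf-here true y ys _ = here refl

consIf-there : ∀ {A : Set} b (y q : A) ys → q LM.∈ ys → q LM.∈ consIf b y ys
consIf-there true y q ys p = there p
consIf-there false y q ys p = p

totalSize : ℕ → (ℕ → Block) → ℕ
totalSize zero masks = 0
totalSize (suc k) masks = totalSize k masks + size (masks k)

module MaskedEdges (n : ℕ) (s0 : Bool) (masks : ℕ → Block) where

  maskedEdges : EdgeSet (G n)
  maskedEdges = toEdgeSet n s0 masks

  slotIndex : ∀ j → j < n → Slot → EdgeIx (G n)
  slotIndex j jn p = encode n (edgeAt (LC j p)) (locInRange⇒inRange n (LC j p) jn)

  maskIndices : ∀ j → j < n → Block → List (EdgeIx (G n))
  maskIndices j jn x = map (slotIndex j jn) (selected x)

  length-maskIndices : ∀ j jn x → length (maskIndices j jn x) ≡ size x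
  length-maskIndices j jn x = length-map (slotIndex j jn) (selected x)

  ∈maskIndices : ∀ j jn x p → bit x p ≡ true → slotIndex j jn p LM.∈ maskIndices j jn x
  ∈maskIndices j jn x p t = ∈-map⁺ (slotIndex j jn) (∈-selected x p t)

  masksIndices : ∀ k → k ≤ n → List (EdgeIx (G n))
  masksIndices zero _ = []
  masksIndices (suc k) h = masksIndices k (<⇒≤ h) ++ maskIndices k h (masks k)

  length-masksIndices : ∀ k h → length (masksIndices k h) ≡ totalSize k masks
  length-masksIndices zero h = refl
  length-masksIndices (suc k) h = trans (length-++ (masksIndices k (<⇒≤ h))) (cong₂ _+_ (length-masksIndices k (<⇒≤ h)) (length-maskIndices k h (masks k)))

  ∈masksIndices : ∀ k h j jn p → j < k → bit (masks j) p ≡ true → slotIndex j jn p LM.∈ masksIndices k h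
  ∈masksIndices (suc k) h j jn p jk t with m≤n⇒m<n∨m≡n (≤-pred jk)
  ... | inj₁ j<k = ∈-++⁺ˡ (∈masksIndices k (<⇒≤ h) j jn p j<k t)
  ... | inj₂ refl = ∈-++⁺ʳ (masksIndices k (<⇒≤ h)) (subst (LM._∈ maskIndices j h (masks j))
                      (encode-unique n _ _ _ (encode-endpoints n (edgeAt (LC j p)) (locInRange⇒inRange n (LC j p) jn)))
                      (∈maskIndices j h (masks j) p t))

  rung₀Index : EdgeIx (G n)
  rung₀Index = encode n (eVt 0) (s≤s z≤n)

  allMaskIndices : List (EdgeIx (G n))
  allMaskIndices = consIf s0 rung₀Index (masksIndices n ≤-refl)

  length-allMaskIndices : length allMaskIndices ≡ b2n s0 + totalSize n masks
  length-allMaskIndices = trans (length-consIf s0 rung₀Index _) (cong (b2n s0 +_) (length-masksIndices n ≤-refl))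

  maskedEdges⊆allMaskIndices : ∀ i → Vec.lookup maskedEdges i ≡ true → i LM.∈ allMaskIndices
  maskedEdges⊆allMaskIndices i t = locate (locOf (decode n i)) refl (inRange⇒locInRange n (decode n i) (decode-inRange n i))
    where
    t' : bitAt s0 masks (locOf (decode n i)) ≡ true
    t' = trans (sym (lookup∘tabulate (λ i → bitAt s0 masks (locOf (decode n i))) i)) t
    locate : ∀ l → locOf (decode n i) ≡ l → LocInRange n l → i LM.∈ allMaskIndices
    locate L0 eq _ = subst (LM._∈ allMaskIndices) (encode-unique n (eVt 0) (s≤s z≤n) i
        (trans (decode-endpoints n i) (cong ends (trans (sym (edgeAt-locOf (decode n i))) (cong edgeAt eq)))))
        (consIf-here s0 rung₀Index _ (subst (λ l → bitAt s0 masks l ≡ true) eq t'))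
    locate (LC j p) eq jn = consIf-there s0 rung₀Index i _ (subst (LM._∈ masksIndices n ≤-refl) (encode-unique n _ _ i
        (trans (decode-endpoints n i) (cong ends (trans (sym (edgeAt-locOf (decode n i))) (cong edgeAt eq)))))
        (∈masksIndices n ≤-refl j jn p jn (subst (λ l → bitAt s0 masks l ≡ true) eq t')))

  ∣maskedEdges∣≤ : ∣ maskedEdges ∣ ≤ b2n s0 + totalSize n masks
  ∣maskedEdges∣≤ = subst (∣ maskedEdges ∣ ≤_) length-allMaskIndices (∣ maskedEdges ∣≤length maskedEdges⊆allMaskIndices)

  module Forcing (c0 : Bool) (cl : ℕ → Block) (ok : IsChain n c0 cl)
            (m0 : s0 ≡ true → c0 ≡ false)
            (masks-avoid : ∀ j → j < n → disjointᵇ (masks j) (cl j) ≡ true)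
            (forced : ∀ c0' cl' → IsChain n c0' cl' → (s0 ≡ true → c0' ≡ false) →
                     (∀ j → j < n → disjointᵇ (masks j) (cl' j) ≡ true) → (c0' ≡ c0) × (∀ j → j < n → cl' j ≡ cl j)) where

    M : EdgeSet (G n)
    M = toEdgeSet n c0 cl

    lookup-maskedEdges : ∀ i → Vec.lookup maskedEdges i ≡ bitAt s0 masks (locOf (decode n i))
    lookup-maskedEdges i = lookup∘tabulate (λ i → bitAt s0 masks (locOf (decode n i))) i

    lookup-blocks : ∀ (M' : EdgeSet (G n)) i → Vec.lookup M' i ≡ bitAt (rung₀ n M') (blockAt n M') (locOf (decode n i))
    lookup-blocks M' i = sym (trans (bitAt-locOf n M' (decode n i)) (member-decode n M' i))

    masked⇒unmatched : ∀ c0' cl' l → LocInRange n l → (s0 ≡ true → c0' ≡ false) → (∀ j → j < n → disjointᵇ (masks j) (cl' j) ≡ true) →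
                  bitAt s0 masks l ≡ true → bitAt c0' cl' l ≡ false
    masked⇒unmatched c0' cl' L0 _ h0 hd t = h0 t
    masked⇒unmatched c0' cl' (LC j p) jn h0 hd t = settle (bit (cl' j) p) refl
      where
      dj = allSlots-sound (λ q → not (bit (masks j) q ∧ bit (cl' j) q)) (hd j jn) p
      settle : ∀ b → bit (cl' j) p ≡ b → b ≡ false
      settle false _ = refl
      settle true e with trans (sym dj) (cong (λ q → not (q ∧ bit (cl' j) p)) t)
      ... | q rewrite e with q
      ... | ()

    masked∉M : ∀ i → i FS.∈ maskedEdges → ¬ (i FS.∈ M)
    masked∉M i iS iM = settle (trans (sym (trans (lookup-blocks M i) (bitAt-cong (rung₀-toEdgeSet n c0 cl) (blockAt-toEdgeSet n c0 cl ok) (locOf (decode n i))))) ([]=⇒lookup iM))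
      where
      settle : bitAt c0 cl (locOf (decode n i)) ≡ true → ⊥
      settle t with trans (sym t) (masked⇒unmatched c0 cl (locOf (decode n i)) (inRange⇒locInRange n (decode n i) (decode-inRange n i)) m0 masks-avoid
                   (trans (sym (lookup-maskedEdges i)) ([]=⇒lookup iS)))
      ... | ()

    M-unique : ∀ M' → IsPerfectMatching (G n) M' → (∀ i → i FS.∈ maskedEdges → ¬ (i FS.∈ M')) → M' ≡ M
    M-unique M' pm av = chain-ext n M' M (trans e0 (sym (rung₀-toEdgeSet n c0 cl))) ec
      where
      ok' = perfect⇒IsChain n M' pm
      h0 : s0 ≡ true → rung₀ n M' ≡ false
      h0 t = ¬true⇒false (λ t' → av rung₀Index (lookup⇒[]= rung₀Index maskedEdges (trans (trans (lookup-maskedEdges rung₀Index) (cong (λ e → bitAt s0 masks (locOf e)) (decode-encode n (eVt 0) (s≤s z≤n)))) t))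
                      (lookup⇒[]= rung₀Index M' (trans (lookup-blocks M' rung₀Index) (trans (cong (λ e → bitAt (rung₀ n M') (blockAt n M') (locOf e)) (decode-encode n (eVt 0) (s≤s z≤n))) t'))))
      hd : ∀ j → j < n → disjointᵇ (masks j) (blockAt n M' j) ≡ true
      hd j jn = allSlots-complete (λ q → not (bit (masks j) q ∧ bit (blockAt n M' j) q)) λ p → settle p (bit (masks j) p) refl
        where
        settle : ∀ p b → bit (masks j) p ≡ b → not (b ∧ bit (blockAt n M' j) p) ≡ true
        settle p false _ = refl
        settle p true e = cong not (¬true⇒false (λ t' → av (slotIndex j jn p)
          (lookup⇒[]= (slotIndex j jn p) maskedEdges (trans (lookup-maskedEdges (slotIndex j jn p)) (trans (cong (λ e → bitAt s0 masks (locOf e)) (decode-encode n _ _))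
             (trans (cong (bitAt s0 masks) (locOf-edgeAt (LC j p))) e))))
          (lookup⇒[]= (slotIndex j jn p) M' (trans (lookup-blocks M' (slotIndex j jn p)) (trans (cong (λ e → bitAt (rung₀ n M') (blockAt n M') (locOf e)) (decode-encode n _ _))
             (trans (cong (bitAt (rung₀ n M') (blockAt n M')) (locOf-edgeAt (LC j p))) t'))))))
      fr = forced (rung₀ n M') (blockAt n M') ok' h0 hd
      e0 = proj₁ fr
      ec : ∀ j → blockAt n M' j ≡ blockAt n M j
      ec j with n ≤? j
      ... | yes nj = trans (blockAt-beyond n M' j nj) (sym (blockAt-beyond n M j nj))
      ... | no nj = trans (proj₂ fr j (≰⇒> nj)) (sym (blockAt-toEdgeSet n c0 cl ok j))

    anti-forcing : IsAntiForcingSet (G n) M maskedEdges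
    anti-forcing = masked∉M , M-unique

record Deviation (n : ℕ) (c0 : Bool) (cl : ℕ → Block) (κ : Loc → ℕ × ℕ) (t : ℕ × ℕ) : Set where
  field
    rung₀′ : Bool
    blocks′ : ℕ → Block
    chain′ : IsChain n rung₀′ blocks′
    changed : Loc
    changed-inRange : LocInRange n changed
    changed-now : bitAt rung₀′ blocks′ changed ≡ true
    changed-before : bitAt c0 cl changed ≡ false
    new-labelled : ∀ l → LocInRange n l → bitAt rung₀′ blocks′ l ≡ true → bitAt c0 cl l ≡ false → κ l ≡ t

toEdgeSet-lookup : ∀ n c0 cl i → Vec.lookup (toEdgeSet n c0 cl) i ≡ bitAt c0 cl (locOf (decode n i))
toEdgeSet-lookup n c0 cl i = lookup∘tabulate (λ i → bitAt c0 cl (locOf (decode n i))) i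

toEdgeSet-lookup-at : ∀ n c0 cl l (h : LocInRange n l) → Vec.lookup (toEdgeSet n c0 cl) (encode n (edgeAt l) (locInRange⇒inRange n l h)) ≡ bitAt c0 cl l
toEdgeSet-lookup-at n c0 cl l h = trans (toEdgeSet-lookup n c0 cl _) (trans (cong (λ e → bitAt c0 cl (locOf e)) (decode-encode n _ _)) (cong (bitAt c0 cl) (locOf-edgeAt l)))

module _ {n : ℕ} {c0 : Bool} {cl : ℕ → Block} {κ : Loc → ℕ × ℕ} {t : ℕ × ℕ} (D : Deviation n c0 cl κ t) where

  open Deviation D

  private
    differs : toEdgeSet n rung₀′ blocks′ ≢ toEdgeSet n c0 cl
    differs eq = true≢false (trans (sym changed-now) (trans (sym (toEdgeSet-lookup-at n rung₀′ blocks′ changed changed-inRange))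
                   (trans (cong (λ X → Vec.lookup X (encode n (edgeAt changed) (locInRange⇒inRange n changed changed-inRange))) eq)
                          (trans (toEdgeSet-lookup-at n c0 cl changed changed-inRange) changed-before))))

  deviation⇒alternative : Alternative (G n) (toEdgeSet n c0 cl) (λ i → κ (locOf (decode n i))) t
  deviation⇒alternative = record
    { matching = toEdgeSet n rung₀′ blocks′
    ; perfect = toEdgeSet-perfect n rung₀′ blocks′ chain′
    ; ≢M = differs
    ; labelled = λ i i∈D i∉M → new-labelled (locOf (decode n i)) (inRange⇒locInRange n (decode n i) (decode-inRange n i))
                   (trans (sym (toEdgeSet-lookup n rung₀′ blocks′ i)) i∈D) (trans (sym (toEdgeSet-lookup n c0 cl i)) i∉M)
    }

-- Every perfect matching has an anti-forcing set of size at most 3n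

Forces : Block → Bool → Bool → Block → Set
Forces x r1 r2 m = ∀ y → isLocalMatching y r1 r2 ≡ true → disjointᵇ m y ≡ true → y ≡ x

partner-unique : ∀ a b b' → exactlyOne (a ∷ b ∷ []) ≡ true → exactlyOne (a ∷ b' ∷ []) ≡ true → b ≡ b'
partner-unique true false false _ _ = refl
partner-unique false true true _ _ = refl
partner-unique true true _ () _
partner-unique true false true _ ()
partner-unique false false _ () _
partner-unique false true false _ ()

module Sweep (n : ℕ) (c0 c0' : Bool) (cl cl' : ℕ → Block) (ok : IsChain n c0 cl) (ok' : IsChain n c0' cl')
               (masks : ℕ → Block) (masks-force : ∀ j → j < n → Forces (cl j) (lu (cl (suc j))) (lv (cl (suc j))) (masks j))
               (av : ∀ j → j < n → disjointᵇ (masks j) (cl' j) ≡ true) where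

  next-agrees : ∀ j → (suc j < n → cl' (suc j) ≡ cl (suc j)) → cl' (suc j) ≡ cl (suc j)
  next-agrees j h with n ≤? suc j
  ... | yes nj = trans (IsChain.beyond ok' (suc j) nj) (sym (IsChain.beyond ok (suc j) nj))
  ... | no nj = h (≰⇒> nj)

  agrees-within : ∀ k j → n ≤ j + k → j < n → cl' j ≡ cl j
  agrees-within zero j h jn = ⊥-elim (<⇒≱ jn (subst (n ≤_) (+-identityʳ j) h))
  agrees-within (suc k) j h jn = masks-force j jn (cl' j)
      (subst (λ x → isLocalMatching (cl' j) (lu x) (lv x) ≡ true) e (IsChain.local ok' j jn)) (av j jn)
    where
    e : cl' (suc j) ≡ cl (suc j)
    e = next-agrees j (λ sjn → agrees-within k (suc j) (subst (n ≤_) (+-suc j k) h) sjn)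

  agrees : ∀ j → j < n → cl' j ≡ cl j
  agrees j jn = agrees-within n j (≤-trans (m≤n+m n j) ≤-refl) jn

  agrees-everywhere : ∀ j → cl' j ≡ cl j
  agrees-everywhere j with n ≤? j
  ... | yes nj = trans (IsChain.beyond ok' j nj) (sym (IsChain.beyond ok j nj))
  ... | no nj = agrees j (≰⇒> nj)

  rung₀-agrees : c0' ≡ c0
  rung₀-agrees = partner-unique (lu (cl 0)) c0' c0 (subst (λ x → exactlyOne (lu x ∷ c0' ∷ []) ≡ true) (agrees-everywhere 0) (IsChain.u₀-covered ok')) (IsChain.u₀-covered ok)

forcerOf : Maybe BlockType → Block
forcerOf (just c) = forcer c
forcerOf nothing = emptyBlock

module ForcerMasks (n : ℕ) (c0 : Bool) (cl : ℕ → Block) (ok : IsChain n c0 cl) where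

  masks : ℕ → Block
  masks j = forcerOf (findType (cl j) (lu (cl (suc j))) (lv (cl (suc j))))

  masks-avoid : ∀ j → j < n → disjointᵇ (masks j) (cl j) ≡ true
  masks-avoid j jn with classify (cl j) (lu (cl (suc j))) (lv (cl (suc j))) (IsChain.local ok j jn)
  ... | c , ef , tc , r1 , r2 = subst₂ (λ a b → disjointᵇ a b ≡ true) (sym (cong forcerOf ef)) tc (forcer-avoids c)

  masks-force : ∀ j → j < n → Forces (cl j) (lu (cl (suc j))) (lv (cl (suc j))) (masks j)
  masks-force j jn y ly dj with classify (cl j) (lu (cl (suc j))) (lv (cl (suc j))) (IsChain.local ok j jn)
                      | classify y (lu (cl (suc j))) (lv (cl (suc j))) ly
  ... | c , ef , tc , r1 , r2 | d , _ , td , s1 , s2 =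
    trans (sym td) (trans (forcer-forces c d (trans r1 (sym s1)) (trans r2 (sym s2))
      (subst₂ (λ a b → disjointᵇ a b ≡ true) (cong forcerOf ef) (sym td) dj)) tc)

  size-mask≤3 : ∀ j → j < n → size (masks j) ≤ 3
  size-mask≤3 j jn with classify (cl j) (lu (cl (suc j))) (lv (cl (suc j))) (IsChain.local ok j jn)
  ... | c , ef , tc , r1 , r2 = subst (λ a → size a ≤ 3) (sym (cong forcerOf ef)) (size-forcer≤3 c)

  totalSize≤3* : ∀ k → k ≤ n → totalSize k masks ≤ 3 * k
  totalSize≤3* zero _ = z≤n
  totalSize≤3* (suc k) h = subst (totalSize k masks + size (masks k) ≤_) (trans (+-comm (3 * k) 3) (sym (*-suc 3 k)))
                     (+-mono-≤ (totalSize≤3* k (<⇒≤ h)) (size-mask≤3 k h))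

  forced : ∀ c0' cl' → IsChain n c0' cl' → (false ≡ true → c0' ≡ false) →
          (∀ j → j < n → disjointᵇ (masks j) (cl' j) ≡ true) → (c0' ≡ c0) × (∀ j → j < n → cl' j ≡ cl j)
  forced c0' cl' ok' _ av = Sweep.rung₀-agrees n c0 c0' cl cl' ok ok' masks masks-force av , Sweep.agrees n c0 c0' cl cl' ok ok' masks masks-force av

-- Every anti-forcing set has at least n edges

leftSquareToRungs : Block → Block
leftSquareToRungs x = record x { lu = false ; lv = false ; va = true }

leftSquareToEntries : Block → Block
leftSquareToEntries x = record x { lu = true ; lv = true ; va = false }

withRungB : Bool → Block → Block
withRungB b x = record x { vb = b }

innerSwitch : BlockType → Block
innerSwitch cB = shape cD
innerSwitch cC = shape cB
innerSwitch cD = shape cB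
innerSwitch cE = shape cF
innerSwitch cF = shape cC
innerSwitch c = shape c

innerSwitch₂ : BlockType → Block
innerSwitch₂ cB = shape cC
innerSwitch₂ cC = shape cF
innerSwitch₂ cD = shape cF
innerSwitch₂ cF = shape cD
innerSwitch₂ c = shape c

-- The blocks m and m+1 (of types c' and c) of a perfect matching that differs from the
-- given one on a single alternating cycle: a face of block m+1, or the square left of it.
pairSwitch : BlockType → BlockType → Block × Block
pairSwitch c' cT = withRungB true (shape c') , leftSquareToRungs (shape cT)
pairSwitch c' cA = withRungB true (shape c') , leftSquareToRungs (shape cA)
pairSwitch cA cG = withRungB false (shape cA) , leftSquareToEntries (shape cG)
pairSwitch cE cG = withRungB false (shape cE) , leftSquareToEntries (shape cG)
pairSwitch c' cG = innerSwitch₂ c' , shape cG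
pairSwitch c' c = shape c' , innerSwitch c

switchedˡ switchedʳ : BlockType → BlockType → Block
switchedˡ c' c = proj₁ (pairSwitch c' c)
switchedʳ c' c = proj₂ (pairSwitch c' c)

-- The same for block 0, whose left square contains the rung u₀v₀ (the first component).
firstSwitch : BlockType → Bool × Block
firstSwitch cT = true , leftSquareToRungs (shape cT)
firstSwitch cA = true , leftSquareToRungs (shape cA)
firstSwitch cG = false , leftSquareToEntries (shape cG)
firstSwitch c = true , innerSwitch c

isRungB : Slot → Bool
isRungB pVb = true
isRungB _ = false

isTypeG : Block → Bool
isTypeG x with typeOf x
... | just cG = true
... | _ = false

inInnerSwitch₂ : Block → Slot → Bool
inInnerSwitch₂ x p with typeOf x
... | just cB = newB p
  where
  newB : Slot → Bool
  newB pZZ = true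
  newB pHv = true
  newB _ = false
... | just cC = newC p
  where
  newC : Slot → Bool
  newC pWW = true
  newC pHu = true
  newC _ = false
... | just cD = newD p
  where
  newD : Slot → Bool
  newD pZZ = true
  newD pHv = true
  newD _ = false
... | just cF = newF p
  where
  newF : Slot → Bool
  newF pZa = true
  newF pZb = true
  newF _ = false
... | _ = false

-- A new edge in block i (of block x, followed by block y) borrowed by the switch for block i+1.
attributedToNext : Block → Block → Slot → Bool
attributedToNext x y p = (isRungB p ∧ lu y) ∨ (inInnerSwitch₂ x p ∧ isTypeG y)

attributedToNext-false : ∀ x y p → isRungB p ≡ false → inInnerSwitch₂ x p ≡ false → attributedToNext x y p ≡ false
attributedToNext-false x y p e1 e2 rewrite e1 | e2 = refl

newOnly : Block → Block → (Slot → Bool) → Bool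
newOnly y x f = allSlots λ p → (bit y p ∧ not (bit x p)) ⇒ᵇ f p

newOnly-sound : ∀ y x f → newOnly y x f ≡ true → ∀ p → bit y p ≡ true → bit x p ≡ false → f p ≡ true
newOnly-sound y x f h p e1 e2 =
  ⇒ᵇ-elim (allSlots-sound (λ p → (bit y p ∧ not (bit x p)) ⇒ᵇ f p) h p) (∧-intro e1 (false⇒not-true e2))

adjacent : BlockType → BlockType → Bool
adjacent c' c = (exitU c' ≡ᵇ lu (shape c)) ∧ (exitV c' ≡ᵇ lv (shape c)) ∧ (lu (shape c) ≡ᵇ lv (shape c)) ∧ (lu (shape c') ≡ᵇ lv (shape c'))

adjacent-intro : ∀ c' c → exitU c' ≡ lu (shape c) → exitV c' ≡ lv (shape c) → lu (shape c) ≡ lv (shape c) →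
  lu (shape c') ≡ lv (shape c') → adjacent c' c ≡ true
adjacent-intro c' c e1 e2 e3 e4 = ∧-intro (≡ᵇ-complete e1) (∧-intro (≡ᵇ-complete e2) (∧-intro (≡ᵇ-complete e3) (≡ᵇ-complete e4)))

-- (true , p): slot p of block m; (false , p): slot p of block m+1.
pairWitnessSlot : BlockType → BlockType → Bool × Slot
pairWitnessSlot c' cT = false , pVa
pairWitnessSlot c' cA = false , pVa
pairWitnessSlot cA cG = false , pLu
pairWitnessSlot cE cG = false , pLu
pairWitnessSlot cB cG = true , pZZ
pairWitnessSlot cC cG = true , pWW
pairWitnessSlot cD cG = true , pZZ
pairWitnessSlot cF cG = true , pZa
pairWitnessSlot c' cB = false , pWW
pairWitnessSlot c' cC = false , pZa
pairWitnessSlot c' cD = false , pWa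
pairWitnessSlot c' cE = false , pHu
pairWitnessSlot c' cF = false , pWa
pairWitnessSlot c' c = false , pHu

pairSwitch-changes : BlockType → BlockType → Bool
pairSwitch-changes c' c with pairWitnessSlot c' c
... | true , p = bit (switchedˡ c' c) p ∧ not (bit (shape c') p)
... | false , p = bit (switchedʳ c' c) p ∧ not (bit (shape c) p)

PairFact : (BlockType → BlockType → Bool) → Set
PairFact f = ∀ c' c → adjacent c' c ≡ true → f c' c ≡ true

pairFact : ∀ f → allPairsᵇ (λ c' c → adjacent c' c ⇒ᵇ f c' c) ≡ true → PairFact f
pairFact f h c' c a = ⇒ᵇ-elim (allPairs-sound (λ c' c → adjacent c' c ⇒ᵇ f c' c) h c' c) a

pair-local : PairFact λ c' c → isLocalMatching (switchedˡ c' c) (lu (switchedʳ c' c)) (lv (switchedʳ c' c))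
pair-local = pairFact _ refl

pair-exits : PairFact λ c' c → isLocalMatching (switchedʳ c' c) (exitU c) (exitV c)
pair-exits = pairFact _ refl

pair-entry : PairFact λ c' c → (lu (switchedˡ c' c) ≡ᵇ lu (shape c')) ∧ (lv (switchedˡ c' c) ≡ᵇ lv (shape c'))
pair-entry = pairFact _ refl

pair-changes : PairFact pairSwitch-changes
pair-changes = pairFact _ refl

entersBalanced : BlockType → Bool
entersBalanced c = lu (shape c) ≡ᵇ lv (shape c)

firstWitnessSlot : BlockType → Maybe Slot
firstWitnessSlot cG = just pLu
firstWitnessSlot cB = just pWW
firstWitnessSlot cC = just pZa
firstWitnessSlot cD = just pWa
firstWitnessSlot cE = just pHu
firstWitnessSlot cF = just pWa
firstWitnessSlot _ = nothing

firstSwitch-changes : BlockType → Bool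
firstSwitch-changes c with firstWitnessSlot c
... | nothing = proj₁ (firstSwitch c) ∧ lu (shape c)
... | just p = bit (proj₂ (firstSwitch c)) p ∧ not (bit (shape c) p)

FirstFact : (BlockType → Bool) → Set
FirstFact f = ∀ c → entersBalanced c ≡ true → f c ≡ true

firstFact : ∀ f → allTypesᵇ (λ c → entersBalanced c ⇒ᵇ f c) ≡ true → FirstFact f
firstFact f h c a = ⇒ᵇ-elim (allTypes-sound (λ c → entersBalanced c ⇒ᵇ f c) h c) a

first-u₀ : FirstFact λ c → exactlyOne (lu (proj₂ (firstSwitch c)) ∷ proj₁ (firstSwitch c) ∷ [])
first-u₀ = firstFact _ refl

first-v₀ : FirstFact λ c → exactlyOne (lv (proj₂ (firstSwitch c)) ∷ proj₁ (firstSwitch c) ∷ [])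
first-v₀ = firstFact _ refl

first-exits : FirstFact λ c → isLocalMatching (proj₂ (firstSwitch c)) (exitU c) (exitV c)
first-exits = firstFact _ refl

first-changes : FirstFact firstSwitch-changes
first-changes = firstFact _ refl

kept⇒not-attributed : ∀ x y p → not (isRungB p) ∧ not (inInnerSwitch₂ x p) ≡ true → attributedToNext x y p ≡ false
kept⇒not-attributed x y p h =
  attributedToNext-false x y p (not-true⇒false (∧-projˡ _ h)) (not-true⇒false (∧-projʳ (not (isRungB p)) h))

pair-newˡ-attributed : ∀ c' c → adjacent c' c ≡ true → ∀ p → bit (switchedˡ c' c) p ≡ true → bit (shape c') p ≡ false →
  attributedToNext (shape c') (shape c) p ≡ true
pair-newˡ-attributed c' c a = newOnly-sound (switchedˡ c' c) (shape c') (attributedToNext (shape c') (shape c))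
  (pairFact (λ c' c → newOnly (switchedˡ c' c) (shape c') (attributedToNext (shape c') (shape c))) refl c' c a)

pair-newʳ-not-attributed : ∀ c' c → adjacent c' c ≡ true → ∀ y p → bit (switchedʳ c' c) p ≡ true → bit (shape c) p ≡ false →
  attributedToNext (shape c) y p ≡ false
pair-newʳ-not-attributed c' c a y p e1 e2 = kept⇒not-attributed (shape c) y p
  (newOnly-sound (switchedʳ c' c) (shape c) (λ p → not (isRungB p) ∧ not (inInnerSwitch₂ (shape c) p))
    (pairFact (λ c' c → newOnly (switchedʳ c' c) (shape c) λ p → not (isRungB p) ∧ not (inInnerSwitch₂ (shape c) p)) refl c' c a)
    p e1 e2)

first-new-not-attributed : ∀ c → entersBalanced c ≡ true → ∀ y p → bit (proj₂ (firstSwitch c)) p ≡ true →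
  bit (shape c) p ≡ false → attributedToNext (shape c) y p ≡ false
first-new-not-attributed c a y p e1 e2 = kept⇒not-attributed (shape c) y p
  (newOnly-sound (proj₂ (firstSwitch c)) (shape c) (λ p → not (isRungB p) ∧ not (inInnerSwitch₂ (shape c) p))
    (firstFact (λ c → newOnly (proj₂ (firstSwitch c)) (shape c) λ p → not (isRungB p) ∧ not (inInnerSwitch₂ (shape c) p)) refl c a)
    p e1 e2)

update : (ℕ → Block) → ℕ → Block → ℕ → Block
update cl j x i with i ≟ j
... | yes _ = x
... | no _ = cl i

update-≡ : ∀ cl j x → update cl j x j ≡ x
update-≡ cl j x with j ≟ j
... | yes _ = refl
... | no ne = ⊥-elim (ne refl)

update-≢ : ∀ cl j x i → i ≢ j → update cl j x i ≡ cl i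
update-≢ cl j x i ne with i ≟ j
... | yes e = ⊥-elim (ne e)
... | no _ = refl

module ReplaceBlock (n : ℕ) (c0 : Bool) (cl : ℕ → Block) (ok : IsChain n c0 cl) (i : ℕ) (i<n : i < n) (y : Block)
          (elu : lu y ≡ lu (cl i)) (elv : lv y ≡ lv (cl i))
          (lc : isLocalMatching y (lu (cl (suc i))) (lv (cl (suc i))) ≡ true) where

  cl' : ℕ → Block
  cl' = update cl i y

  lu-pres : ∀ j → lu (cl' j) ≡ lu (cl j)
  lu-pres j with j ≟ i
  ... | yes refl = elu
  ... | no _ = refl

  lv-pres : ∀ j → lv (cl' j) ≡ lv (cl j)
  lv-pres j with j ≟ i
  ... | yes refl = elv
  ... | no _ = refl

  ok' : IsChain n c0 cl'
  ok' = record
    { beyond = λ j nj → trans (update-≢ cl i y j (λ e → <⇒≱ i<n (subst (n ≤_) e nj))) (IsChain.beyond ok j nj)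
    ; u₀-covered = subst (λ t → exactlyOne (t ∷ c0 ∷ []) ≡ true) (sym (lu-pres 0)) (IsChain.u₀-covered ok)
    ; v₀-covered = subst (λ t → exactlyOne (t ∷ c0 ∷ []) ≡ true) (sym (lv-pres 0)) (IsChain.v₀-covered ok)
    ; local = lc' }
    where
    lc' : ∀ j → j < n → isLocalMatching (cl' j) (lu (cl' (suc j))) (lv (cl' (suc j))) ≡ true
    lc' j jn rewrite lu-pres (suc j) | lv-pres (suc j) with i ≟ j
    ... | yes refl = subst (λ x → isLocalMatching x (lu (cl (suc i))) (lv (cl (suc i))) ≡ true) (sym (update-≡ cl i y)) lc
    ... | no ne = subst (λ x → isLocalMatching x (lu (cl (suc j))) (lv (cl (suc j))) ≡ true) (sym (update-≢ cl i y j (≢-sym ne))) (IsChain.local ok j jn)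

  new : ∀ l → bitAt c0 cl' l ≡ true → bitAt c0 cl l ≡ false → Σ Slot λ p → (l ≡ LC i p) × (bit y p ≡ true) × (bit (cl i) p ≡ false)
  new L0 t f = ⊥-elim (true≢false (trans (sym t) f))
  new (LC j p) t f with i ≟ j
  ... | yes refl = p , refl , trans (sym (cong (λ x → bit x p) (update-≡ cl i y))) t , f
  ... | no ne = ⊥-elim (true≢false (trans (sym t) (trans (cong (λ x → bit x p) (update-≢ cl i y j (≢-sym ne))) f)))

module ReplaceTwoBlocks (n : ℕ) (c0 : Bool) (cl : ℕ → Block) (ok : IsChain n c0 cl) (m : ℕ) (sm<n : suc m < n) (A B : Block)
          (elu : lu A ≡ lu (cl m)) (elv : lv A ≡ lv (cl m))
          (lcA : isLocalMatching A (lu B) (lv B) ≡ true)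
          (lcB : isLocalMatching B (lu (cl (suc (suc m)))) (lv (cl (suc (suc m)))) ≡ true) where

  cl' : ℕ → Block
  cl' = update (update cl (suc m) B) m A

  at-m : cl' m ≡ A
  at-m = update-≡ _ m A

  at-sm : cl' (suc m) ≡ B
  at-sm = trans (update-≢ _ m A (suc m) (λ e → <⇒≢ (n<1+n m) (sym e))) (update-≡ cl (suc m) B)

  other : ∀ j → j ≢ m → j ≢ suc m → cl' j ≡ cl j
  other j e1 e2 = trans (update-≢ _ m A j e1) (update-≢ cl (suc m) B j e2)

  lu-pres : ∀ j → j ≢ suc m → lu (cl' j) ≡ lu (cl j)
  lu-pres j ne with m ≟ j
  ... | yes refl = trans (cong lu at-m) elu
  ... | no ne' = cong lu (other j (≢-sym ne') ne)

  lv-pres : ∀ j → j ≢ suc m → lv (cl' j) ≡ lv (cl j)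
  lv-pres j ne with m ≟ j
  ... | yes refl = trans (cong lv at-m) elv
  ... | no ne' = cong lv (other j (≢-sym ne') ne)

  ok' : IsChain n c0 cl'
  ok' = record
    { beyond = λ j nj → trans (other j (λ e → <⇒≱ (<-trans (n<1+n m) sm<n) (subst (n ≤_) e nj))
                                    (λ e → <⇒≱ sm<n (subst (n ≤_) e nj))) (IsChain.beyond ok j nj)
    ; u₀-covered = subst (λ t → exactlyOne (t ∷ c0 ∷ []) ≡ true) (sym (lu-pres 0 (λ ()))) (IsChain.u₀-covered ok)
    ; v₀-covered = subst (λ t → exactlyOne (t ∷ c0 ∷ []) ≡ true) (sym (lv-pres 0 (λ ()))) (IsChain.v₀-covered ok)
    ; local = lc' }
    where
    lc' : ∀ j → j < n → isLocalMatching (cl' j) (lu (cl' (suc j))) (lv (cl' (suc j))) ≡ true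
    lc' j jn with m ≟ j
    ... | yes refl = subst₂ (λ x y → isLocalMatching x (lu y) (lv y) ≡ true) (sym at-m) (sym at-sm) lcA
    ... | no ne0 with suc m ≟ j
    ...   | yes refl rewrite lu-pres (suc (suc m)) (λ e → <⇒≢ (n<1+n (suc m)) (sym e))
                           | lv-pres (suc (suc m)) (λ e → <⇒≢ (n<1+n (suc m)) (sym e)) =
               subst (λ x → isLocalMatching x (lu (cl (suc (suc m)))) (lv (cl (suc (suc m)))) ≡ true) (sym at-sm) lcB
    ...   | no ne20 rewrite lu-pres (suc j) (λ e → ne0 (sym (suc-injective e))) | lv-pres (suc j) (λ e → ne0 (sym (suc-injective e))) =
               subst (λ x → isLocalMatching x (lu (cl (suc j))) (lv (cl (suc j))) ≡ true) (sym (other j (≢-sym ne0) (≢-sym ne20))) (IsChain.local ok j jn)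

  new : ∀ l → bitAt c0 cl' l ≡ true → bitAt c0 cl l ≡ false →
        (Σ Slot λ p → (l ≡ LC m p) × (bit A p ≡ true) × (bit (cl m) p ≡ false)) ⊎
        (Σ Slot λ p → (l ≡ LC (suc m) p) × (bit B p ≡ true) × (bit (cl (suc m)) p ≡ false))
  new L0 t f = ⊥-elim (true≢false (trans (sym t) f))
  new (LC j p) t f with m ≟ j
  ... | yes refl = inj₁ (p , refl , trans (sym (cong (λ x → bit x p) at-m)) t , f)
  ... | no ne with suc m ≟ j
  ...   | yes refl = inj₂ (p , refl , trans (sym (cong (λ x → bit x p) at-sm)) t , f)
  ...   | no ne2 = ⊥-elim (true≢false (trans (sym t) (trans (cong (λ x → bit x p) (other j (≢-sym ne) (≢-sym ne2))) f)))

module ReplaceFirstBlock (n : ℕ) (c0 : Bool) (cl : ℕ → Block) (ok : IsChain n c0 cl) (0<n : 0 < n) (b0 : Bool) (B : Block)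
          (e1 : exactlyOne (lu B ∷ b0 ∷ []) ≡ true) (e2 : exactlyOne (lv B ∷ b0 ∷ []) ≡ true)
          (lcB : isLocalMatching B (lu (cl 1)) (lv (cl 1)) ≡ true) where

  cl' : ℕ → Block
  cl' = update cl 0 B

  ok' : IsChain n b0 cl'
  ok' = record
    { beyond = λ j nj → trans (update-≢ cl 0 B j (λ e → <⇒≱ 0<n (subst (n ≤_) e nj))) (IsChain.beyond ok j nj)
    ; u₀-covered = subst (λ x → exactlyOne (lu x ∷ b0 ∷ []) ≡ true) (sym (update-≡ cl 0 B)) e1
    ; v₀-covered = subst (λ x → exactlyOne (lv x ∷ b0 ∷ []) ≡ true) (sym (update-≡ cl 0 B)) e2
    ; local = lc' }
    where
    lc' : ∀ j → j < n → isLocalMatching (cl' j) (lu (cl' (suc j))) (lv (cl' (suc j))) ≡ true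
    lc' zero jn rewrite update-≢ cl 0 B 1 (λ ()) = subst (λ x → isLocalMatching x (lu (cl 1)) (lv (cl 1)) ≡ true) (sym (update-≡ cl 0 B)) lcB
    lc' (suc j) jn rewrite update-≢ cl 0 B (suc j) (λ ()) | update-≢ cl 0 B (suc (suc j)) (λ ()) = IsChain.local ok (suc j) jn

  new : ∀ l → bitAt b0 cl' l ≡ true → bitAt c0 cl l ≡ false →
        ((l ≡ L0) × (b0 ≡ true) × (c0 ≡ false)) ⊎
        (Σ Slot λ p → (l ≡ LC 0 p) × (bit B p ≡ true) × (bit (cl 0) p ≡ false))
  new L0 t f = inj₁ (refl , t , f)
  new (LC zero p) t f = inj₂ (p , refl , trans (sym (cong (λ x → bit x p) (update-≡ cl 0 B))) t , f)
  new (LC (suc j) p) t f = ⊥-elim (true≢false (trans (sym t) (trans (cong (λ x → bit x p) (update-≢ cl 0 B (suc j) (λ ()))) f)))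

partner-unique′ : ∀ a a' b → exactlyOne (a ∷ b ∷ []) ≡ true → exactlyOne (a' ∷ b ∷ []) ≡ true → a ≡ a'
partner-unique′ true true _ _ _ = refl
partner-unique′ false false _ _ _ = refl
partner-unique′ true false true () _
partner-unique′ true false false _ ()
partner-unique′ false true true _ ()
partner-unique′ false true false () _

exactlyOne-true : ∀ b → exactlyOne (true ∷ b ∷ []) ≡ true → b ≡ false
exactlyOne-true false _ = refl
exactlyOne-true true ()

-- Every block j has a perfect matching deviating from the given one on a single
-- alternating cycle (pairSwitch, firstSwitch); the labels put all its new edges into
-- class j, so by anti-forcing-lower-bound every anti-forcing set has at least n edges.
shiftLabel : (ℕ → Block) → Loc → ℕ × ℕ
shiftLabel cl L0 = 0 , 0
shiftLabel cl (LC i p) = (if attributedToNext (cl i) (cl (suc i)) p then suc i else i) , 0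

module BlockDeviations (n : ℕ) (c0 : Bool) (cl : ℕ → Block) (ok : IsChain n c0 cl) where

  balanced : ∀ j → j < n → lu (cl j) ≡ lv (cl j)
  balanced zero _ = partner-unique′ (lu (cl 0)) (lv (cl 0)) c0 (IsChain.u₀-covered ok) (IsChain.v₀-covered ok)
  balanced (suc j) sjn with classify (cl j) (lu (cl (suc j))) (lv (cl (suc j))) (IsChain.local ok j (<-trans (n<1+n j) sjn))
  ... | c , _ , tc , r1 , r2 =
    trans (sym r1) (trans (balanced-exits c (trans (cong lu tc) (trans (balanced j (<-trans (n<1+n j) sjn)) (cong lv (sym tc))))) r2)

  private
    balanced-type : ∀ {j c} → j < n → shape c ≡ cl j → lu (shape c) ≡ lv (shape c)
    balanced-type {j} jn tc = trans (cong lu tc) (trans (balanced j jn) (cong lv (sym tc)))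

  first-deviation : 0 < n → Deviation n c0 cl (shiftLabel cl) (0 , 0)
  first-deviation 0<n with classify (cl 0) (lu (cl 1)) (lv (cl 1)) (IsChain.local ok 0 0<n)
  ... | c , _ , tc , r1 , r2 = record
      { rung₀′ = b₀ ; blocks′ = R.cl' ; chain′ = R.ok'
      ; changed = proj₁ witness ; changed-inRange = proj₁ (proj₂ witness) ; changed-now = proj₁ (proj₂ (proj₂ witness)) ; changed-before = proj₂ (proj₂ (proj₂ witness))
      ; new-labelled = labelled }
    where
    hz : entersBalanced c ≡ true
    hz = ≡ᵇ-complete (balanced-type 0<n tc)
    b₀ = proj₁ (firstSwitch c)
    B = proj₂ (firstSwitch c)
    module R = ReplaceFirstBlock n c0 cl ok 0<n b₀ B (first-u₀ c hz) (first-v₀ c hz)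
                 (subst₂ (λ a b → isLocalMatching B a b ≡ true) r1 r2 (first-exits c hz))
    witness : Σ Loc λ l → LocInRange n l × bitAt b₀ R.cl' l ≡ true × bitAt c0 cl l ≡ false
    witness with firstWitnessSlot c | first-changes c hz
    ... | nothing | k = L0 , _ , ∧-projˡ b₀ k ,
          exactlyOne-true c0 (subst (λ t → exactlyOne (t ∷ c0 ∷ []) ≡ true) (trans (cong lu (sym tc)) (∧-projʳ b₀ k)) (IsChain.u₀-covered ok))
    ... | just p | k = LC 0 p , 0<n , trans (cong (λ x → bit x p) (update-≡ cl 0 B)) (∧-projˡ (bit B p) k) ,
          trans (cong (λ x → bit x p) (sym tc)) (not-true⇒false (∧-projʳ (bit B p) k))
    labelled : ∀ l → LocInRange n l → bitAt b₀ R.cl' l ≡ true → bitAt c0 cl l ≡ false → shiftLabel cl l ≡ (0 , 0)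
    labelled l _ t f with R.new l t f
    ... | inj₁ (refl , _ , _) = refl
    ... | inj₂ (p , refl , g1 , g0)
      rewrite subst (λ x → attributedToNext x (cl 1) p ≡ false) tc
                (first-new-not-attributed c hz (cl 1) p g1 (trans (cong (λ x → bit x p) tc) g0)) = refl

  next-deviation : ∀ m → suc m < n → Deviation n c0 cl (shiftLabel cl) (suc m , 0)
  next-deviation m sm<n
    with classify (cl m) (lu (cl (suc m))) (lv (cl (suc m))) (IsChain.local ok m (<-trans (n<1+n m) sm<n))
       | classify (cl (suc m)) (lu (cl (suc (suc m)))) (lv (cl (suc (suc m)))) (IsChain.local ok (suc m) sm<n)
  ... | c' , _ , tc' , r1' , r2' | c , _ , tc , r1 , r2 = record
      { rung₀′ = c0 ; blocks′ = R.cl' ; chain′ = R.ok'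
      ; changed = proj₁ witness ; changed-inRange = proj₁ (proj₂ witness) ; changed-now = proj₁ (proj₂ (proj₂ witness)) ; changed-before = proj₂ (proj₂ (proj₂ witness))
      ; new-labelled = labelled }
    where
    hp : adjacent c' c ≡ true
    hp = adjacent-intro c' c (trans r1' (cong lu (sym tc))) (trans r2' (cong lv (sym tc)))
           (balanced-type sm<n tc) (balanced-type (<-trans (n<1+n m) sm<n) tc')
    A = switchedˡ c' c
    B = switchedʳ c' c
    module R = ReplaceTwoBlocks n c0 cl ok m sm<n A B
                 (trans (≡ᵇ-sound _ _ (∧-projˡ _ (pair-entry c' c hp))) (cong lu tc'))
                 (trans (≡ᵇ-sound _ _ (∧-projʳ (lu A ≡ᵇ lu (shape c')) (pair-entry c' c hp))) (cong lv tc'))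
                 (pair-local c' c hp) (subst₂ (λ a b → isLocalMatching B a b ≡ true) r1 r2 (pair-exits c' c hp))
    witness : Σ Loc λ l → LocInRange n l × bitAt c0 R.cl' l ≡ true × bitAt c0 cl l ≡ false
    witness with pairWitnessSlot c' c | pair-changes c' c hp
    ... | true , p | k = LC m p , <-trans (n<1+n m) sm<n ,
          trans (cong (λ x → bit x p) R.at-m) (∧-projˡ (bit A p) k) ,
          trans (cong (λ x → bit x p) (sym tc')) (not-true⇒false (∧-projʳ (bit A p) k))
    ... | false , p | k = LC (suc m) p , sm<n ,
          trans (cong (λ x → bit x p) R.at-sm) (∧-projˡ (bit B p) k) ,
          trans (cong (λ x → bit x p) (sym tc)) (not-true⇒false (∧-projʳ (bit B p) k))
    labelled : ∀ l → LocInRange n l → bitAt c0 R.cl' l ≡ true → bitAt c0 cl l ≡ false → shiftLabel cl l ≡ (suc m , 0)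
    labelled l _ t f with R.new l t f
    ... | inj₁ (p , refl , g1 , g0)
      rewrite subst₂ (λ x y → attributedToNext x y p ≡ true) tc' tc
                (pair-newˡ-attributed c' c hp p g1 (trans (cong (λ x → bit x p) tc') g0)) = refl
    ... | inj₂ (p , refl , g1 , g0)
      rewrite subst (λ x → attributedToNext x (cl (suc (suc m))) p ≡ false) tc
                (pair-newʳ-not-attributed c' c hp (cl (suc (suc m))) p g1 (trans (cong (λ x → bit x p) tc) g0)) = refl

  deviation : ∀ j → j < n → Deviation n c0 cl (shiftLabel cl) (j , 0)
  deviation zero = first-deviation
  deviation (suc m) = next-deviation m

concatUpTo : (ℕ → List (ℕ × ℕ)) → ℕ → List (ℕ × ℕ)
concatUpTo labelsOf zero = []
concatUpTo labelsOf (suc k) = concatUpTo labelsOf k ++ labelsOf k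

sumLengthsUpTo : (ℕ → List (ℕ × ℕ)) → ℕ → ℕ
sumLengthsUpTo labelsOf zero = 0
sumLengthsUpTo labelsOf (suc k) = sumLengthsUpTo labelsOf k + length (labelsOf k)

length-concatUpTo : ∀ labelsOf k → length (concatUpTo labelsOf k) ≡ sumLengthsUpTo labelsOf k
length-concatUpTo labelsOf zero = refl
length-concatUpTo labelsOf (suc k) = trans (length-++ (concatUpTo labelsOf k)) (cong (_+ length (labelsOf k)) (length-concatUpTo labelsOf k))

module _ (labelsOf : ℕ → List (ℕ × ℕ)) (fst : ∀ k → All (λ t → proj₁ t ≡ k) (labelsOf k)) (ub : ∀ k → Unique (labelsOf k)) where

  concatUpTo-bounded : ∀ k → All (λ t → proj₁ t < k) (concatUpTo labelsOf k)
  concatUpTo-bounded zero = []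
  concatUpTo-bounded (suc k) = AllP.++⁺ (All.map (λ h → <-trans h (n<1+n k)) (concatUpTo-bounded k)) (All.map (λ e → ≤-reflexive (cong suc e)) (fst k))

  concatUpTo-unique : ∀ k → Unique (concatUpTo labelsOf k)
  concatUpTo-unique zero = []
  concatUpTo-unique (suc k) = UP.++⁺ (concatUpTo-unique k) (ub k)
    (λ (p , q) → <-irrefl (All.lookup (fst k) q) (All.lookup (concatUpTo-bounded k) p))

∈-concatUpTo : ∀ labelsOf k t → t LM.∈ concatUpTo labelsOf k → Σ ℕ λ j → j < k × t LM.∈ labelsOf j
∈-concatUpTo labelsOf (suc k) t p with ∈-++⁻ (concatUpTo labelsOf k) p
... | inj₁ q with ∈-concatUpTo labelsOf k t q
... | j , jk , r = j , <-trans jk (n<1+n k) , r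
∈-concatUpTo labelsOf (suc k) t p | inj₂ q = k , n<1+n k , q

spectrum-member : ∀ n c0 cl → IsChain n c0 cl → (s0 : Bool) (masks : ℕ → Block) →
  (s0 ≡ true → c0 ≡ false) → (∀ j → j < n → disjointᵇ (masks j) (cl j) ≡ true) →
  (∀ c0' cl' → IsChain n c0' cl' → (s0 ≡ true → c0' ≡ false) →
     (∀ j → j < n → disjointᵇ (masks j) (cl' j) ≡ true) → (c0' ≡ c0) × (∀ j → j < n → cl' j ≡ cl j)) →
  (κ : Loc → ℕ × ℕ) (ts : List (ℕ × ℕ)) → Unique ts → (∀ t → t LM.∈ ts → Deviation n c0 cl κ t) →
  b2n s0 + totalSize n masks ≤ length ts →
  InAntiForcingSpectrum (G n) (length ts)
spectrum-member n c0 cl ok s0 masks m0 md forced κ ts uts deviations sz =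
  toEdgeSet n c0 cl , toEdgeSet-perfect n c0 cl ok ,
  (maskedEdges , anti-forcing , ≤-antisym (≤-trans ∣maskedEdges∣≤ sz) (lower maskedEdges anti-forcing)) , lower
  where
  open MaskedEdges n s0 masks
  open Forcing c0 cl ok m0 md forced
  lower : ∀ S → IsAntiForcingSet (G n) (toEdgeSet n c0 cl) S → length ts ≤ ∣ S ∣
  lower S af = anti-forcing-lower-bound (G n) af _ ts uts (λ t p → deviation⇒alternative (deviations t p))

blockLabels : ℕ → List (ℕ × ℕ)
blockLabels = concatUpTo (λ k → (k , 0) ∷ [])

length-blockLabels : ∀ n → length (blockLabels n) ≡ n
length-blockLabels n = trans (length-concatUpTo _ n) (sum-ones n)
  where
  sum-ones : ∀ n → sumLengthsUpTo (λ k → (k , 0) ∷ []) n ≡ n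
  sum-ones zero = refl
  sum-ones (suc n) = trans (+-comm (sumLengthsUpTo _ n) 1) (cong suc (sum-ones n))

blockLabels-unique : ∀ n → Unique (blockLabels n)
blockLabels-unique n = concatUpTo-unique (λ k → (k , 0) ∷ []) (λ k → refl ∷ []) (λ k → [] ∷ []) n

module _ (n : ℕ) (M : EdgeSet (G n)) (pm : IsPerfectMatching (G n) M) where

  private
    c0 = rung₀ n M
    cl = blockAt n M
    ok = perfect⇒IsChain n M pm

    chain≡M : toEdgeSet n c0 cl ≡ M
    chain≡M = chain-ext n (toEdgeSet n c0 cl) M (rung₀-toEdgeSet n c0 cl) (blockAt-toEdgeSet n c0 cl ok)

    open ForcerMasks n c0 cl ok
    open MaskedEdges n false masks

  anti-forcing-set≤3n : Σ[ S ∈ EdgeSet (G n) ] (IsAntiForcingSet (G n) M S × ∣ S ∣ ≤ 3 * n)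
  anti-forcing-set≤3n =
    maskedEdges ,
    subst (λ X → IsAntiForcingSet (G n) X maskedEdges) chain≡M (Forcing.anti-forcing c0 cl ok (λ ()) masks-avoid forced) ,
    ≤-trans ∣maskedEdges∣≤ (totalSize≤3* n ≤-refl)

  n≤anti-forcing-set : ∀ S → IsAntiForcingSet (G n) M S → n ≤ ∣ S ∣
  n≤anti-forcing-set S af = subst (_≤ ∣ S ∣) (length-blockLabels n)
    (anti-forcing-lower-bound (G n) (subst (λ X → IsAntiForcingSet (G n) X S) (sym chain≡M) af) _ (blockLabels n) (blockLabels-unique n)
      (λ t t∈ → deviation⇒alternative (deviation-for t (∈-concatUpTo _ n t t∈))))
    where
    deviation-for : ∀ t → Σ ℕ (λ j → j < n × t LM.∈ ((j , 0) ∷ [])) → Deviation n c0 cl (shiftLabel cl) t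
    deviation-for t (j , jn , here refl) = BlockDeviations.deviation n c0 cl ok j jn

spectrum-bounds : ∀ n k → InAntiForcingSpectrum (G n) k → (n ≤ k) × (k ≤ 3 * n)
spectrum-bounds n k (M , pm , (S , af , ∣S∣≡k) , minimal) =
  subst (n ≤_) ∣S∣≡k (n≤anti-forcing-set n M pm S af) ,
  ≤-trans (minimal _ (proj₁ (proj₂ (anti-forcing-set≤3n n M pm)))) (proj₂ (proj₂ (anti-forcing-set≤3n n M pm)))

-- Perfect matchings with prescribed anti-forcing number

-- In the explicit families the new edges of the alternative matchings used for block i
-- are labelled (i, class of their slot); labelF2 gives the rung u_b v_b of block i to the
-- square left of block i+1.
slotClass : Slot → ℕ
slotClass pHu = 0
slotClass pHv = 1
slotClass pVa = 2
slotClass pVb = 2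
slotClass pWa = 0
slotClass pWb = 0
slotClass pWW = 0
slotClass pZa = 1
slotClass pZb = 1
slotClass pZZ = 1
slotClass pLu = 3
slotClass pLv = 3

labelF1 : Loc → ℕ × ℕ
labelF1 L0 = 0 , 9
labelF1 (LC i p) = i , slotClass p

labelF2 : Loc → ℕ × ℕ
labelF2 L0 = 0 , 2
labelF2 (LC i p) = (if isRungB p then suc i else i) , slotClass p

labelF1-new : ∀ y x k → newOnly y x (λ p → slotClass p Nat.≡ᵇ k) ≡ true →
  ∀ i p → bit y p ≡ true → bit x p ≡ false → labelF1 (LC i p) ≡ (i , k)
labelF1-new y x k h i p e1 e2 =
  cong (i ,_) (≡ᵇ⇒≡ _ _ (Equivalence.from T-≡ (newOnly-sound y x (λ p → slotClass p Nat.≡ᵇ k) h p e1 e2)))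

labelF2-new : ∀ y x r k → newOnly y x (λ p → (isRungB p ≡ᵇ r) ∧ (slotClass p Nat.≡ᵇ k)) ≡ true →
  ∀ i p → bit y p ≡ true → bit x p ≡ false → labelF2 (LC i p) ≡ ((if r then suc i else i) , k)
labelF2-new y x r k h i p e1 e2 =
  cong₂ (λ b c → (if b then suc i else i) , c) (≡ᵇ-sound _ _ (∧-projˡ _ new))
    (≡ᵇ⇒≡ _ _ (Equivalence.from T-≡ (∧-projʳ (isRungB p ≡ᵇ r) new)))
  where
  new = newOnly-sound y x (λ p → (isRungB p ≡ᵇ r) ∧ (slotClass p Nat.≡ᵇ k)) h p e1 e2

module SingleBlockDeviation (n : ℕ) (c0 : Bool) (cl : ℕ → Block) (ok : IsChain n c0 cl) (κ : Loc → ℕ × ℕ) where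
  deviation₁ : ∀ j → j < n → (x y : Block) → cl j ≡ x → lu y ≡ lu x → lv y ≡ lv x →
         isLocalMatching y (lu (cl (suc j))) (lv (cl (suc j))) ≡ true → (p0 : Slot) → bit y p0 ≡ true → bit x p0 ≡ false →
         (s : ℕ × ℕ) → (∀ p → bit y p ≡ true → bit x p ≡ false → κ (LC j p) ≡ s) → Deviation n c0 cl κ s
  deviation₁ j jn x y cl≡x ly lv' lc p0 g1 g0 s nk = record
    { rung₀′ = c0 ; blocks′ = R.cl' ; chain′ = R.ok'
    ; changed = LC j p0 ; changed-inRange = jn ; changed-now = trans (cong (λ c → bit c p0) (update-≡ cl j y)) g1
    ; changed-before = trans (cong (λ c → bit c p0) cl≡x) g0
    ; new-labelled = labelled }
    where
    module R = ReplaceBlock n c0 cl ok j jn y (trans ly (cong lu (sym cl≡x))) (trans lv' (cong lv (sym cl≡x))) lc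
    labelled : ∀ l → LocInRange n l → bitAt c0 R.cl' l ≡ true → bitAt c0 cl l ≡ false → κ l ≡ s
    labelled l _ t f with R.new l t f
    ... | p , refl , h1 , h0 = nk p h1 (trans (cong (λ c → bit c p) (sym cl≡x)) h0)

∸-suc : ∀ {q k} → q ≤ k → suc k ∸ q ≡ suc (k ∸ q)
∸-suc z≤n = refl
∸-suc (s≤s h) = ∸-suc h

cost-step-B : ∀ k → k + k + 0 + 2 ≡ suc k + suc k + 0
cost-step-B = solve-∀

cost-step-F : ∀ k d → k + k + d + 3 ≡ suc k + suc k + suc d
cost-step-F = solve-∀

-- The chain B…BF…F with q blocks B; a block B needs two forbidden edges, a block F three.
module HighAntiForcing (n q : ℕ) (q≤n : q ≤ n) where

  chainᴴ : ℕ → Block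
  chainᴴ i with i <? q
  ... | yes _ = shape cB
  ... | no _ with i <? n
  ...   | yes _ = shape cF
  ...   | no _ = emptyBlock

  chainᴴ-lu : ∀ i → lu (chainᴴ i) ≡ false
  chainᴴ-lu i with i <? q
  ... | yes _ = refl
  ... | no _ with i <? n
  ...   | yes _ = refl
  ...   | no _ = refl

  chainᴴ-lv : ∀ i → lv (chainᴴ i) ≡ false
  chainᴴ-lv i with i <? q
  ... | yes _ = refl
  ... | no _ with i <? n
  ...   | yes _ = refl
  ...   | no _ = refl

  chainᴴ-beyond : ∀ i → n ≤ i → chainᴴ i ≡ emptyBlock
  chainᴴ-beyond i ni with i <? q
  ... | yes iq = ⊥-elim (<⇒≱ (<-≤-trans iq q≤n) ni)
  ... | no _ with i <? n
  ...   | yes i<n = ⊥-elim (<⇒≱ i<n ni)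
  ...   | no _ = refl

  ok : IsChain n true chainᴴ
  ok = record
    { beyond = chainᴴ-beyond
    ; u₀-covered = subst (λ t → exactlyOne (t ∷ true ∷ []) ≡ true) (sym (chainᴴ-lu 0)) refl
    ; v₀-covered = subst (λ t → exactlyOne (t ∷ true ∷ []) ≡ true) (sym (chainᴴ-lv 0)) refl
    ; local = lc }
    where
    lc : ∀ j → j < n → isLocalMatching (chainᴴ j) (lu (chainᴴ (suc j))) (lv (chainᴴ (suc j))) ≡ true
    lc j jn rewrite chainᴴ-lu (suc j) | chainᴴ-lv (suc j) with j <? q
    ... | yes _ = refl
    ... | no _ with j <? n
    ...   | yes _ = refl
    ...   | no ¬jn = ⊥-elim (¬jn jn)

  open ForcerMasks n true chainᴴ ok

  labelsOf : ℕ → List (ℕ × ℕ)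
  labelsOf k with k <? q
  ... | yes _ = (k , 0) ∷ (k , 1) ∷ []
  ... | no _ = (k , 0) ∷ (k , 1) ∷ (k , 2) ∷ []

  labelsOf-block : ∀ k → All (λ t → proj₁ t ≡ k) (labelsOf k)
  labelsOf-block k with k <? q
  ... | yes _ = refl ∷ refl ∷ []
  ... | no _ = refl ∷ refl ∷ refl ∷ []

  labelsOf-unique : ∀ k → Unique (labelsOf k)
  labelsOf-unique k with k <? q
  ... | yes _ = ((λ ()) ∷ []) ∷ [] ∷ []
  ... | no _ = ((λ ()) ∷ (λ ()) ∷ []) ∷ ((λ ()) ∷ []) ∷ [] ∷ []

  ts : List (ℕ × ℕ)
  ts = concatUpTo labelsOf n

  size-mask≡length-labelsOf : ∀ j → j < n → size (masks j) ≡ length (labelsOf j)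
  size-mask≡length-labelsOf j jn rewrite chainᴴ-lu (suc j) | chainᴴ-lv (suc j) with j <? q
  ... | yes _ = cong (λ m → size (forcerOf m)) (findType-shape cB)
  ... | no _ with j <? n
  ...   | yes _ = cong (λ m → size (forcerOf m)) (findType-shape cF)
  ...   | no ¬jn = ⊥-elim (¬jn jn)

  totalSize≡sumLengths : ∀ k → k ≤ n → totalSize k masks ≡ sumLengthsUpTo labelsOf k
  totalSize≡sumLengths zero _ = refl
  totalSize≡sumLengths (suc k) h = cong₂ _+_ (totalSize≡sumLengths k (<⇒≤ h)) (size-mask≡length-labelsOf k h)

  deviations : ∀ t → t LM.∈ ts → Deviation n true chainᴴ labelF1 t
  deviations t tin with ∈-concatUpTo labelsOf n t tin
  ... | j , jn , tb = deviation-in-block tb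
    where
    open SingleBlockDeviation n true chainᴴ ok labelF1
    lc : ∀ y → isLocalMatching y false false ≡ true → isLocalMatching y (lu (chainᴴ (suc j))) (lv (chainᴴ (suc j))) ≡ true
    lc y h rewrite chainᴴ-lu (suc j) | chainᴴ-lv (suc j) = h
    deviation-in-block : t LM.∈ labelsOf j → Deviation n true chainᴴ labelF1 t
    deviation-in-block tb with j <? q | tb
    ... | yes jq | here refl = deviation₁ j jn (shape cB) (shape cD) chainᴴ≡B refl refl (lc (shape cD) refl) pWW refl refl _ (labelF1-new (shape cD) (shape cB) 0 refl j)
      where chainᴴ≡B : chainᴴ j ≡ shape cB
            chainᴴ≡B with j <? q
            ... | yes _ = refl
            ... | no ¬jq = ⊥-elim (¬jq jq)
    ... | yes jq | there (here refl) = deviation₁ j jn (shape cB) (shape cC) chainᴴ≡B refl refl (lc (shape cC) refl) pHv refl refl _ (labelF1-new (shape cC) (shape cB) 1 refl j)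
      where chainᴴ≡B : chainᴴ j ≡ shape cB
            chainᴴ≡B with j <? q
            ... | yes _ = refl
            ... | no ¬jq = ⊥-elim (¬jq jq)
    ... | no ¬jq | here refl = deviation₁ j jn (shape cF) (shape cC) chainᴴ≡F refl refl (lc (shape cC) refl) pWa refl refl _ (labelF1-new (shape cC) (shape cF) 0 refl j)
      where chainᴴ≡F : chainᴴ j ≡ shape cF
            chainᴴ≡F with j <? q
            ... | yes jq = ⊥-elim (¬jq jq)
            ... | no _ with j <? n
            ...   | yes _ = refl
            ...   | no ¬jn = ⊥-elim (¬jn jn)
    ... | no ¬jq | there (here refl) = deviation₁ j jn (shape cF) (shape cD) chainᴴ≡F refl refl (lc (shape cD) refl) pZa refl refl _ (labelF1-new (shape cD) (shape cF) 1 refl j)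
      where chainᴴ≡F : chainᴴ j ≡ shape cF
            chainᴴ≡F with j <? q
            ... | yes jq = ⊥-elim (¬jq jq)
            ... | no _ with j <? n
            ...   | yes _ = refl
            ...   | no ¬jn = ⊥-elim (¬jn jn)
    ... | no ¬jq | there (there (here refl)) = deviation₁ j jn (shape cF) (shape cE) chainᴴ≡F refl refl (lc (shape cE) refl) pVa refl refl _ (labelF1-new (shape cE) (shape cF) 2 refl j)
      where chainᴴ≡F : chainᴴ j ≡ shape cF
            chainᴴ≡F with j <? q
            ... | yes jq = ⊥-elim (¬jq jq)
            ... | no _ with j <? n
            ...   | yes _ = refl
            ...   | no ¬jn = ⊥-elim (¬jn jn)

  ∈spectrum : InAntiForcingSpectrum (G n) (length ts)
  ∈spectrum = spectrum-member n true chainᴴ ok false masks (λ ()) masks-avoid forced labelF1 ts (concatUpTo-unique labelsOf labelsOf-block labelsOf-unique n) deviations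
           (≤-reflexive (trans (totalSize≡sumLengths n ≤-refl) (sym (length-concatUpTo labelsOf n))))

  cost : ∀ k → sumLengthsUpTo labelsOf k ≡ k + k + (k ∸ q)
  cost zero = sym (0∸n≡0 q)
  cost (suc k) with k <? q
  ... | yes kq rewrite cost k | m≤n⇒m∸n≡0 (<⇒≤ kq) | m≤n⇒m∸n≡0 kq = cost-step-B k
  ... | no ¬kq rewrite cost k | ∸-suc (≮⇒≥ ¬kq) = cost-step-F k (k ∸ q)

  length-ts : length ts ≡ n + n + (n ∸ q)
  length-ts = trans (length-concatUpTo labelsOf n) (cost n)

exactlyOne-false : ∀ a → exactlyOne (a ∷ false ∷ []) ≡ true → a ≡ true
exactlyOne-false true _ = refl
exactlyOne-false false ()

-- The chain T…TAB…B with p blocks T; blocks T and A need one forbidden edge, B two.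
module LowAntiForcing (n p : ℕ) (p<n : p < n) where

  chainᴸ : ℕ → Block
  chainᴸ i with i <? p
  ... | yes _ = shape cT
  ... | no _ with i ≟ p
  ...   | yes _ = shape cA
  ...   | no _ with i <? n
  ...     | yes _ = shape cB
  ...     | no _ = emptyBlock

  chainᴸ-T : ∀ i → i < p → chainᴸ i ≡ shape cT
  chainᴸ-T i ip with i <? p
  ... | yes _ = refl
  ... | no ¬ip = ⊥-elim (¬ip ip)

  chainᴸ-A : chainᴸ p ≡ shape cA
  chainᴸ-A with p <? p
  ... | yes pp = ⊥-elim (<-irrefl refl pp)
  ... | no _ with p ≟ p
  ...   | yes _ = refl
  ...   | no ne = ⊥-elim (ne refl)

  chainᴸ-B : ∀ i → p < i → i < n → chainᴸ i ≡ shape cB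
  chainᴸ-B i pi i<n with i <? p
  ... | yes ip = ⊥-elim (<-asym ip pi)
  ... | no _ with i ≟ p
  ...   | yes refl = ⊥-elim (<-irrefl refl pi)
  ...   | no _ with i <? n
  ...     | yes _ = refl
  ...     | no ¬i = ⊥-elim (¬i i<n)

  chainᴸ-beyond : ∀ i → n ≤ i → chainᴸ i ≡ emptyBlock
  chainᴸ-beyond i ni with i <? p
  ... | yes ip = ⊥-elim (<⇒≱ (<-trans ip p<n) ni)
  ... | no _ with i ≟ p
  ...   | yes refl = ⊥-elim (<⇒≱ p<n ni)
  ...   | no _ with i <? n
  ...     | yes i<n = ⊥-elim (<⇒≱ i<n ni)
  ...     | no _ = refl

  data Position (i : ℕ) : Set where
    lt : i < p → Position i
    eq : i ≡ p → Position i
    gt : p < i → Position i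

  position : ∀ i → Position i
  position i with <-cmp i p
  ... | tri< a _ _ = lt a
  ... | tri≈ _ b _ = eq b
  ... | tri> _ _ c = gt c

  chainᴸ-entered : ∀ i → i ≤ p → (lu (chainᴸ i) ≡ true) × (lv (chainᴸ i) ≡ true)
  chainᴸ-entered i ip with m≤n⇒m<n∨m≡n ip
  ... | inj₁ lt' rewrite chainᴸ-T i lt' = refl , refl
  ... | inj₂ refl rewrite chainᴸ-A = refl , refl

  chainᴸ-not-entered : ∀ i → p < i → (lu (chainᴸ i) ≡ false) × (lv (chainᴸ i) ≡ false)
  chainᴸ-not-entered i pi with i <? n
  ... | yes i<n rewrite chainᴸ-B i pi i<n = refl , refl
  ... | no ¬i rewrite chainᴸ-beyond i (≮⇒≥ ¬i) = refl , refl

  ok : IsChain n false chainᴸ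
  ok = record
    { beyond = chainᴸ-beyond
    ; u₀-covered = subst (λ t → exactlyOne (t ∷ false ∷ []) ≡ true) (sym (proj₁ (chainᴸ-entered 0 z≤n))) refl
    ; v₀-covered = subst (λ t → exactlyOne (t ∷ false ∷ []) ≡ true) (sym (proj₂ (chainᴸ-entered 0 z≤n))) refl
    ; local = lc }
    where
    lc : ∀ j → j < n → isLocalMatching (chainᴸ j) (lu (chainᴸ (suc j))) (lv (chainᴸ (suc j))) ≡ true
    lc j jn with position j
    ... | lt jp rewrite chainᴸ-T j jp | proj₁ (chainᴸ-entered (suc j) jp) | proj₂ (chainᴸ-entered (suc j) jp) = refl
    ... | eq refl rewrite chainᴸ-A | proj₁ (chainᴸ-not-entered (suc j) ≤-refl) | proj₂ (chainᴸ-not-entered (suc j) ≤-refl) = refl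
    ... | gt pj rewrite chainᴸ-B j pj jn | proj₁ (chainᴸ-not-entered (suc j) (<-trans pj (n<1+n j))) | proj₂ (chainᴸ-not-entered (suc j) (<-trans pj (n<1+n j))) = refl

  masks : ℕ → Block
  masks j with j <? p
  ... | yes _ = rung-b
  ... | no _ with j ≟ p
  ...   | yes _ = emptyBlock
  ...   | no _ = forcer cB

  masksᴸ-T : ∀ j → j < p → masks j ≡ rung-b
  masksᴸ-T j jp with j <? p
  ... | yes _ = refl
  ... | no ¬jp = ⊥-elim (¬jp jp)

  masksᴸ-A : masks p ≡ emptyBlock
  masksᴸ-A with p <? p
  ... | yes pp = ⊥-elim (<-irrefl refl pp)
  ... | no _ with p ≟ p
  ...   | yes _ = refl
  ...   | no ne = ⊥-elim (ne refl)

  masksᴸ-B : ∀ j → p < j → masks j ≡ forcer cB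
  masksᴸ-B j pj with j <? p
  ... | yes jp = ⊥-elim (<-asym jp pj)
  ... | no _ with j ≟ p
  ...   | yes refl = ⊥-elim (<-irrefl refl pj)
  ...   | no _ = refl

  masks-avoid : ∀ j → j < n → disjointᵇ (masks j) (chainᴸ j) ≡ true
  masks-avoid j jn with position j
  ... | lt jp rewrite masksᴸ-T j jp | chainᴸ-T j jp = refl
  ... | eq refl rewrite masksᴸ-A = refl
  ... | gt pj rewrite masksᴸ-B j pj | chainᴸ-B j pj jn = refl

  module Forced (c0' : Bool) (cl' : ℕ → Block) (ok' : IsChain n c0' cl') (h0 : true ≡ true → c0' ≡ false)
               (av : ∀ j → j < n → disjointᵇ (masks j) (cl' j) ≡ true) where

    rung₀-free : c0' ≡ false
    rung₀-free = h0 refl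

    entered : ∀ i → i ≤ p → (lu (cl' i) ≡ true) × (lv (cl' i) ≡ true)
    entered zero _ = exactlyOne-false (lu (cl' 0)) (subst (λ c → exactlyOne (lu (cl' 0) ∷ c ∷ []) ≡ true) rung₀-free (IsChain.u₀-covered ok')) ,
                exactlyOne-false (lv (cl' 0)) (subst (λ c → exactlyOne (lv (cl' 0) ∷ c ∷ []) ≡ true) rung₀-free (IsChain.v₀-covered ok'))
    entered (suc i) sip with classify (cl' i) (lu (cl' (suc i))) (lv (cl' (suc i))) (IsChain.local ok' i (<-trans sip p<n))
    ... | d , _ , td , s1 , s2 with rung-b-forces-cT d (trans (cong lu td) (proj₁ (entered i (<⇒≤ sip)))) (trans (cong lv td) (proj₂ (entered i (<⇒≤ sip))))
                                     (subst₂ (λ a b → disjointᵇ a b ≡ true) (masksᴸ-T i sip) (sym td) (av i (<-trans sip p<n)))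
    ... | _ , e1 , e2 = trans (sym s1) e1 , trans (sym s2) e2

    forced-T : ∀ i → i < p → cl' i ≡ shape cT
    forced-T i ip with classify (cl' i) (lu (cl' (suc i))) (lv (cl' (suc i))) (IsChain.local ok' i (<-trans ip p<n))
    ... | d , _ , td , s1 , s2 = trans (sym td) (proj₁ (rung-b-forces-cT d (trans (cong lu td) (proj₁ (entered i (<⇒≤ ip))))
                                     (trans (cong lv td) (proj₂ (entered i (<⇒≤ ip))))
                                     (subst₂ (λ a b → disjointᵇ a b ≡ true) (masksᴸ-T i ip) (sym td) (av i (<-trans ip p<n)))))

    forced-B-from : ∀ k i → n ≤ i + k → p < i → i < n → cl' i ≡ shape cB
    exits-closed : ∀ k i → n ≤ i + suc k → p ≤ i → (lu (cl' (suc i)) ≡ false) × (lv (cl' (suc i)) ≡ false)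
    exits-closed k i h pi with suc i <? n
    ... | yes si<n rewrite forced-B-from k (suc i) (subst (n ≤_) (+-suc i k) h) (s≤s pi) si<n = refl , refl
    ... | no ¬si rewrite IsChain.beyond ok' (suc i) (≮⇒≥ ¬si) = refl , refl
    forced-B-from zero i h pi i<n = ⊥-elim (<⇒≱ i<n (subst (n ≤_) (+-identityʳ i) h))
    forced-B-from (suc k) i h pi i<n with exits-closed k i h (<⇒≤ pi)
    ... | r1 , r2 with classify (cl' i) (lu (cl' (suc i))) (lv (cl' (suc i))) (IsChain.local ok' i i<n)
    ... | d , _ , td , s1 , s2 = trans (sym td) (forcer-forces cB d (sym (trans s1 r1)) (sym (trans s2 r2))
            (subst₂ (λ a b → disjointᵇ a b ≡ true) (masksᴸ-B i pi) (sym td) (av i i<n)))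

    forced-B : ∀ i → p < i → i < n → cl' i ≡ shape cB
    forced-B i pi i<n = forced-B-from n i (≤-trans (m≤n+m n i) ≤-refl) pi i<n

    forced-A : cl' p ≡ shape cA
    forced-A with exits-closed n p (≤-trans (n≤1+n n) (m≤n+m (suc n) p)) ≤-refl
    ... | r1 , r2 with classify (cl' p) (lu (cl' (suc p))) (lv (cl' (suc p))) (IsChain.local ok' p p<n)
    ... | d , _ , td , s1 , s2 = trans (sym td) (enclosed-is-cA d (trans (cong lu td) (proj₁ (entered p ≤-refl)))
            (trans (cong lv td) (proj₂ (entered p ≤-refl))) (trans s1 r1) (trans s2 r2))

    forced-chain : (c0' ≡ false) × (∀ j → j < n → cl' j ≡ chainᴸ j)
    forced-chain = rung₀-free , λ j jn → locate j jn (position j)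
      where
      locate : ∀ j → j < n → Position j → cl' j ≡ chainᴸ j
      locate j jn (lt jp) = trans (forced-T j jp) (sym (chainᴸ-T j jp))
      locate j jn (eq refl) = trans forced-A (sym chainᴸ-A)
      locate j jn (gt pj) = trans (forced-B j pj jn) (sym (chainᴸ-B j pj jn))

  forced : ∀ c0' cl' → IsChain n c0' cl' → (true ≡ true → c0' ≡ false) →
          (∀ j → j < n → disjointᵇ (masks j) (cl' j) ≡ true) → (c0' ≡ false) × (∀ j → j < n → cl' j ≡ chainᴸ j)
  forced c0' cl' ok' h0 av = Forced.forced-chain c0' cl' ok' h0 av

  labelsOf : ℕ → List (ℕ × ℕ)
  labelsOf k with k ≤? p
  ... | yes _ = (k , 2) ∷ []
  ... | no _ = (k , 0) ∷ (k , 1) ∷ []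

  labelsOf-block : ∀ k → All (λ t → proj₁ t ≡ k) (labelsOf k)
  labelsOf-block k with k ≤? p
  ... | yes _ = refl ∷ []
  ... | no _ = refl ∷ refl ∷ []

  labelsOf-unique : ∀ k → Unique (labelsOf k)
  labelsOf-unique k with k ≤? p
  ... | yes _ = [] ∷ []
  ... | no _ = ((λ ()) ∷ []) ∷ [] ∷ []

  length-labelsOf-≤ : ∀ k → k ≤ p → length (labelsOf k) ≡ 1
  length-labelsOf-≤ k kp with k ≤? p
  ... | yes _ = refl
  ... | no ¬kp = ⊥-elim (¬kp kp)

  length-labelsOf-> : ∀ k → p < k → length (labelsOf k) ≡ 2
  length-labelsOf-> k pk with k ≤? p
  ... | yes kp = ⊥-elim (<⇒≱ pk kp)
  ... | no _ = refl

  ts : List (ℕ × ℕ)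
  ts = concatUpTo labelsOf n

  totalSize-TA : ∀ k → k ≤ p → totalSize k masks ≡ sumLengthsUpTo labelsOf k
  totalSize-TA zero _ = refl
  totalSize-TA (suc k) h rewrite masksᴸ-T k h | length-labelsOf-≤ k (<⇒≤ h) = cong (_+ 1) (totalSize-TA k (<⇒≤ h))

  totalSize-B : ∀ k → p < k → suc (totalSize k masks) ≡ sumLengthsUpTo labelsOf k
  totalSize-B (suc k) h with m≤n⇒m<n∨m≡n (≤-pred h)
  ... | inj₁ pk rewrite masksᴸ-B k pk | length-labelsOf-> k pk = cong (_+ 2) (totalSize-B k pk)
  ... | inj₂ refl rewrite masksᴸ-A | length-labelsOf-≤ k ≤-refl | +-identityʳ (totalSize k masks) = trans (+-comm 1 (totalSize k masks)) (cong (_+ 1) (totalSize-TA k ≤-refl))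

  cost-step-B′ : ∀ k d → k + d + 2 ≡ suc k + suc d
  cost-step-B′ = solve-∀
  cost-step-TA : ∀ k → k + 0 + 1 ≡ suc k + 0
  cost-step-TA = solve-∀

  cost : ∀ k → sumLengthsUpTo labelsOf k ≡ k + (k ∸ suc p)
  cost zero = refl
  cost (suc k) with k ≤? p
  ... | yes kp rewrite cost k | m≤n⇒m∸n≡0 (m≤n⇒m≤1+n kp) | m≤n⇒m∸n≡0 kp = cost-step-TA k
  ... | no ¬kp rewrite cost k | ∸-suc (≰⇒> ¬kp) = cost-step-B′ k (k ∸ suc p)

  T-or-A : ∀ i → i ≤ p → (chainᴸ i ≡ shape cT) ⊎ (chainᴸ i ≡ shape cA)
  T-or-A i ip with m≤n⇒m<n∨m≡n ip
  ... | inj₁ lt' = inj₁ (chainᴸ-T i lt')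
  ... | inj₂ refl = inj₂ chainᴸ-A

  leftSquareToRungs-local : ∀ i → i ≤ p → isLocalMatching (leftSquareToRungs (chainᴸ i)) (lu (chainᴸ (suc i))) (lv (chainᴸ (suc i))) ≡ true
  leftSquareToRungs-local i ip with m≤n⇒m<n∨m≡n ip
  ... | inj₁ lt' rewrite chainᴸ-T i lt' | proj₁ (chainᴸ-entered (suc i) lt') | proj₂ (chainᴸ-entered (suc i) lt') = refl
  ... | inj₂ refl rewrite chainᴸ-A | proj₁ (chainᴸ-not-entered (suc i) ≤-refl) | proj₂ (chainᴸ-not-entered (suc i) ≤-refl) = refl

  square-new-labelled : ∀ i q x → (x ≡ shape cT) ⊎ (x ≡ shape cA) → bit (leftSquareToRungs x) q ≡ true → bit x q ≡ false → labelF2 (LC i q) ≡ (i , 2)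
  square-new-labelled i q x (inj₁ refl) g1 g0 = labelF2-new (leftSquareToRungs (shape cT)) (shape cT) false 2 refl i q g1 g0
  square-new-labelled i q x (inj₂ refl) g1 g0 = labelF2-new (leftSquareToRungs (shape cA)) (shape cA) false 2 refl i q g1 g0

  rung-a-unmatched : ∀ x → (x ≡ shape cT) ⊎ (x ≡ shape cA) → va x ≡ false
  rung-a-unmatched x (inj₁ refl) = refl
  rung-a-unmatched x (inj₂ refl) = refl

  square-deviation : ∀ j → j < n → j ≤ p → Deviation n false chainᴸ labelF2 (j , 2)
  square-deviation zero jn _ = record
    { rung₀′ = true ; blocks′ = R.cl' ; chain′ = R.ok'
    ; changed = L0 ; changed-inRange = _ ; changed-now = refl ; changed-before = refl ; new-labelled = labelled }
    where
    module R = ReplaceFirstBlock n false chainᴸ ok jn true (leftSquareToRungs (chainᴸ 0)) refl refl (leftSquareToRungs-local 0 z≤n)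
    labelled : ∀ l → LocInRange n l → bitAt true R.cl' l ≡ true → bitAt false chainᴸ l ≡ false → labelF2 l ≡ (0 , 2)
    labelled l _ t f with R.new l t f
    ... | inj₁ (refl , _ , _) = refl
    ... | inj₂ (q , refl , g1 , g0) = square-new-labelled 0 q (chainᴸ 0) (T-or-A 0 z≤n) g1 g0
  square-deviation (suc m) jn smp = record
    { rung₀′ = false ; blocks′ = R.cl' ; chain′ = R.ok'
    ; changed = LC (suc m) pVa ; changed-inRange = jn
    ; changed-now = cong (λ x → bit x pVa) R.at-sm
    ; changed-before = rung-a-unmatched (chainᴸ (suc m)) (T-or-A (suc m) smp)
    ; new-labelled = labelled }
    where
    A = withRungB true (chainᴸ m)
    B = leftSquareToRungs (chainᴸ (suc m))
    A-local : isLocalMatching A (lu B) (lv B) ≡ true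
    A-local rewrite chainᴸ-T m smp = refl
    module R = ReplaceTwoBlocks n false chainᴸ ok m jn A B refl refl A-local (leftSquareToRungs-local (suc m) smp)
    labelled : ∀ l → LocInRange n l → bitAt false R.cl' l ≡ true → bitAt false chainᴸ l ≡ false → labelF2 l ≡ (suc m , 2)
    labelled l _ t f with R.new l t f
    ... | inj₁ (q , refl , g1 , g0) =
      labelF2-new (withRungB true (shape cT)) (shape cT) true 2 refl m q
        (subst (λ x → bit (withRungB true x) q ≡ true) (chainᴸ-T m smp) g1) (subst (λ x → bit x q ≡ false) (chainᴸ-T m smp) g0)
    ... | inj₂ (q , refl , g1 , g0) = square-new-labelled (suc m) q (chainᴸ (suc m)) (T-or-A (suc m) smp) g1 g0

  deviations : ∀ t → t LM.∈ ts → Deviation n false chainᴸ labelF2 t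
  deviations t tin with ∈-concatUpTo labelsOf n t tin
  ... | j , jn , tb = deviation-in-block tb
    where
    open SingleBlockDeviation n false chainᴸ ok labelF2
    lc : ∀ y → p < j → isLocalMatching y false false ≡ true → isLocalMatching y (lu (chainᴸ (suc j))) (lv (chainᴸ (suc j))) ≡ true
    lc y pj h rewrite proj₁ (chainᴸ-not-entered (suc j) (<-trans pj (n<1+n j))) | proj₂ (chainᴸ-not-entered (suc j) (<-trans pj (n<1+n j))) = h
    deviation-in-block : t LM.∈ labelsOf j → Deviation n false chainᴸ labelF2 t
    deviation-in-block tb with j ≤? p | tb
    ... | yes jp | here refl = square-deviation j jn jp
    ... | no ¬jp | here refl = deviation₁ j jn (shape cB) (shape cD) (chainᴸ-B j (≰⇒> ¬jp) jn) refl refl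
                                  (lc (shape cD) (≰⇒> ¬jp) refl) pWW refl refl _ (labelF2-new (shape cD) (shape cB) false 0 refl j)
    ... | no ¬jp | there (here refl) = deviation₁ j jn (shape cB) (shape cC) (chainᴸ-B j (≰⇒> ¬jp) jn) refl refl
                                  (lc (shape cC) (≰⇒> ¬jp) refl) pHv refl refl _ (labelF2-new (shape cC) (shape cB) false 1 refl j)

  ∈spectrum : InAntiForcingSpectrum (G n) (length ts)
  ∈spectrum = spectrum-member n false chainᴸ ok true masks (λ _ → refl) masks-avoid forced labelF2 ts (concatUpTo-unique labelsOf labelsOf-block labelsOf-unique n) deviations
           (≤-reflexive (trans (totalSize-B n p<n) (sym (length-concatUpTo labelsOf n))))

  length-ts : length ts ≡ n + (n ∸ suc p)
  length-ts = trans (length-concatUpTo labelsOf n) (cost n)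

n∸suc[n∸suc]≡ : ∀ {n d} → d < n → n ∸ suc (n ∸ suc d) ≡ d
n∸suc[n∸suc]≡ {n} {d} d<n = trans (cong (_∸ suc (n ∸ suc d)) n≡) (m+n∸n≡m d (suc (n ∸ suc d)))
  where
  n≡ : n ≡ d + suc (n ∸ suc d)
  n≡ = trans (sym (m+[n∸m]≡n d<n)) (sym (+-suc d (n ∸ suc d)))

n+d∈spectrum : ∀ {n d} → d < n → InAntiForcingSpectrum (G n) (n + d)
n+d∈spectrum {n} {d} d<n =
  subst (λ e → InAntiForcingSpectrum (G n) (n + e)) (n∸suc[n∸suc]≡ d<n)
    (subst (InAntiForcingSpectrum (G n)) (LowAntiForcing.length-ts n (n ∸ suc d) (∸-monoʳ-< (s≤s z≤n) d<n))
      (LowAntiForcing.∈spectrum n (n ∸ suc d) (∸-monoʳ-< (s≤s z≤n) d<n)))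

2n+d∈spectrum : ∀ {n d} → d ≤ n → InAntiForcingSpectrum (G n) (n + n + d)
2n+d∈spectrum {n} {d} d≤n =
  subst (λ e → InAntiForcingSpectrum (G n) (n + n + e)) (m∸[m∸n]≡n d≤n)
    (subst (InAntiForcingSpectrum (G n)) (HighAntiForcing.length-ts n (n ∸ d) (m∸n≤m n d)) (HighAntiForcing.∈spectrum n (n ∸ d) (m∸n≤m n d)))

3*n≡n+n+n : ∀ n → 3 * n ≡ n + n + n
3*n≡n+n+n = solve-∀

spectrum-complete : ∀ {n k} → n ≤ k → k ≤ 3 * n → InAntiForcingSpectrum (G n) k
spectrum-complete {n} {k} n≤k k≤3n with k <? n + n
... | yes k<2n = subst (InAntiForcingSpectrum (G n)) (m+[n∸m]≡n n≤k)
      (n+d∈spectrum (+-cancelˡ-< n (k ∸ n) n (subst (_< n + n) (sym (m+[n∸m]≡n n≤k)) k<2n)))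
... | no k≮2n = subst (InAntiForcingSpectrum (G n)) (m+[n∸m]≡n (≮⇒≥ k≮2n))
      (2n+d∈spectrum (+-cancelˡ-≤ (n + n) (k ∸ (n + n)) n
        (subst₂ _≤_ (sym (m+[n∸m]≡n (≮⇒≥ k≮2n))) (3*n≡n+n+n n) k≤3n)))

corollary4p9 : (n : ℕ) → 1 ≤ n →
    (MinAntiForcing (G n) n × MaxAntiForcing (G n) (3 * n)) ×
    (∀ k → InAntiForcingSpectrum (G n) k ⇔ (n ≤ k × k ≤ 3 * n))
corollary4p9 n _ =
  ((spectrum-complete ≤-refl n≤3n , λ j j∈ → proj₁ (spectrum-bounds n j j∈)) ,
   (spectrum-complete n≤3n ≤-refl , λ j j∈ → proj₂ (spectrum-bounds n j j∈))) ,
  λ k → mk⇔ (spectrum-bounds n k) (λ (n≤k , k≤3n) → spectrum-complete n≤k k≤3n)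
  where
  n≤3n : n ≤ 3 * n
  n≤3n = m≤m+n n (2 * n)
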